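{- For distinct $i,j,k\in\{1,\dots,d\}$ we have $\varpi_8(t_{a_{i,j}}t_{a_{i,k}}t_{a_{i,j}})=\varpi_8(t_{a_{i,k}}t_{a_{i,j}}t_{a_{i,k}})$, and for distinct $i,j,k,l\in\{1,\dots,d\}$ the elements $\varpi_4(t_{a_{i,j}}t_{a_{k,l}})$ and $\varpi_4(t_{a_{k,l}}t_{a_{i,j}})$ have the same image modulo $N^{(2)}$, i.e. $\varpi_4\big(t_{a_{i,j}}t_{a_{k,l}}(t_{a_{k,l}}t_{a_{i,j}})^{ -1}\big)\in N^{(2)}$.
   Context: Let $d\ge 3$, $d\ne4$, and $g=\lfloor (d-1)/2\rfloor$. Let $W$ be an $\mathbb F_2$-vector space with basis $e_1,\dots,e_d$, $W_0$ the subspace with coordinate sum $0$; $\bar V=W_0$ if $d$ is odd, $\bar V=W_0/\langle e_1+\cdots+e_d\rangle$ if $d$ is even. For even-cardinality $I\subseteq\{1,\dots,d\}$, $v_I$ is the image of $\sum_{i\in I}e_i$; $\langle v_I,v_{I'}\rangle=\#(I\cap I')\bmod2$ is a nondegenerate alternating form. Let $V$ be a free $\mathbb Z_2$-module of rank $2g$ with alternating form reducing, under an identification $V/2V=\bar V$, to the form on $\bar V$. $\varpi_{2^n}:\mathrm{Sp}(V)\to\mathrm{Sp}(V/2^nV)$ is reduction, $\Gamma(2^n)=\ker\varpi_{2^n}$, $t_a(v)=v+\langle v,a\rangle a$. For $1\le i<j\le d$ fix $a_{i,j}=a_{j,i}\in V$ reducing to $v_{\{i,j\}}$. The group $\varpi_4(\Gamma(2))$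 is elementary abelian, written additively; for $1\le i<j\le d$ let $[i,j]=[j,i]=\varpi_4(t_a^2)$ for any $a\in V$ reducing to $v_{\{i,j\}}$ (independent of $a$); the $[i,j]$, $1\le i<j\le 2g+1$, form a basis. $N^{(2)}$ is the set of $\sum_{1\le i<j\le 2g+1}c_{i,j}[i,j]$ ($c_{i,j}=c_{j,i}\in\mathbb F_2$) with $\sum_{j\in\{1,\dots,2g+1\}\setminus\{i\}}c_{i,j}=0$ for every $1\le i\le 2g+1$. -}

module Defs where

open import Data.Bool using (Bool; true; false; not; _∧_; _xor_; if_then_else_)
open import Data.Nat using (ℕ; zero; suc; _+_; _*_; _∸_; _^_; _%_; _/_; _≡ᵇ_; _<_; _≤_; ⌊_/2⌋)
open import Data.Fin using (Fin; toℕ)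
open import Data.Product using (Σ; _×_; _,_)
open import Data.Sum using (_⊎_)
open import Data.List using (List; []; _∷_; foldr; filter)
open import Data.Fin using (_<?_)
open import Data.List using (allFin; concatMap; map)
open import Relation.Binary.PropositionalEquality using (_≡_; _≢_)
open import Relation.Nullary using (¬_)
open import Relation.Nullary.Decidable using (⌊_⌋)

-- 2-adic integers ℤ₂ as digit streams: x n is the coefficient of 2^n.

ℤ₂ : Set
ℤ₂ = ℕ → Bool

trunc : ℕ → ℤ₂ → ℕ
trunc zero    x = 0
trunc (suc n) x = trunc n x + (if x n then 2 ^ n else 0)

bit : ℕ → ℕ → Bool
bit zero    m = m % 2 ≡ᵇ 1
bit (suc n) m = bit n ⌊ m /2⌋

0ℤ₂ : ℤ₂
0ℤ₂ _ = false

_+₂_ : ℤ₂ → ℤ₂ → ℤ₂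
(x +₂ y) n = bit n (trunc (suc n) x + trunc (suc n) y)

_*₂_ : ℤ₂ → ℤ₂ → ℤ₂
(x *₂ y) n = bit n (trunc (suc n) x * trunc (suc n) y)

-₂_ : ℤ₂ → ℤ₂
(-₂ x) n = bit n (2 ^ suc n ∸ trunc (suc n) x)

2ℤ₂ : ℤ₂
2ℤ₂ 1 = true
2ℤ₂ _ = false

Σ₂ : (n : ℕ) → (Fin n → ℤ₂) → ℤ₂
Σ₂ n f = foldr (λ i acc → f i +₂ acc) 0ℤ₂ (allFin n)

genus : ℕ → ℕ
genus d = (d ∸ 1) / 2

rank : ℕ → ℕ
rank d = 2 * genus d

Vec₂ : ℕ → Set
Vec₂ r = Fin r → ℤ₂

form : {r : ℕ} → (Fin r → Fin r → ℤ₂) → Vec₂ r → Vec₂ r → ℤ₂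
form {r} B v w = Σ₂ r (λ m → Σ₂ r (λ n → (v m *₂ B m n) *₂ w n))

transv : {r : ℕ} → (Fin r → Fin r → ℤ₂) → Vec₂ r → Vec₂ r → Vec₂ r
transv B a v m = v m +₂ (form B v a *₂ a m)

-- ϖ_{2^k} on elements: V → V / 2^k V  (coordinates mod 2^k)
_≡[mod2^_]_ : {r : ℕ} → Vec₂ r → ℕ → Vec₂ r → Set
v ≡[mod2^ k ] w = ∀ m → trunc k (v m) ≡ trunc k (w m)

-- equality of images under ϖ_{2^k} of two endomorphisms of V:
-- the induced maps on V/2^kV coincide
SameMod2^ : {r : ℕ} → ℕ → (Vec₂ r → Vec₂ r) → (Vec₂ r → Vec₂ r) → Set
SameMod2^ {r} k f h = ∀ (v : Vec₂ r) → f v ≡[mod2^ k ] h v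

red : {r : ℕ} → Vec₂ r → Fin r → Bool
red v m = v m 0

-- The 𝔽₂-space V̄ ⊆ 𝔽₂^d (W₀, modulo the all-ones vector when d is even)

xorSum : (n : ℕ) → (Fin n → Bool) → Bool
xorSum n f = foldr (λ i acc → f i xor acc) false (allFin n)

InW₀ : (d : ℕ) → (Fin d → Bool) → Set
InW₀ d w = xorSum d w ≡ false

_≈V̄[_]_ : {d : ℕ} → (Fin d → Bool) → ℕ → (Fin d → Bool) → Set
_≈V̄[_]_ {d} u _ w = (∀ i → u i ≡ w i) ⊎ ((d % 2 ≡ 0) × (∀ i → u i ≡ not (w i)))

vPair : {d : ℕ} → Fin d → Fin d → Fin d → Bool
vPair i j x = ⌊ x Data.Fin.≟ i ⌋ xor ⌊ x Data.Fin.≟ j ⌋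
  where import Data.Fin

dotF₂ : (d : ℕ) → (Fin d → Bool) → (Fin d → Bool) → Bool
dotF₂ d u w = xorSum d (λ i → u i ∧ w i)

zeroF₂ : {n : ℕ} → Fin n → Bool
zeroF₂ _ = false

linF₂ : {r d : ℕ} → (Fin r → Fin d → Bool) → (Fin r → Bool) → Fin d → Bool
linF₂ {r} u x i = xorSum r (λ m → x m ∧ u m i)

record Setup (d : ℕ) : Set where
  field
    B       : Fin (rank d) → Fin (rank d) → ℤ₂
    B-diag  : ∀ m → B m m ≡ 0ℤ₂
    B-anti  : ∀ m n → B m n ≡ (-₂ B n m)
    -- identification V/2V = V̄ : an 𝔽₂-linear isomorphism 𝔽₂^(2g) → V̄
    ident      : Fin (rank d) → Fin d → Bool
    ident-W₀   : ∀ m → InW₀ d (ident m)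
    ident-inj  : ∀ x → linF₂ ident x ≈V̄[ d ] zeroF₂ → ∀ m → x m ≡ false
    ident-surj : ∀ w → InW₀ d w → Σ (Fin (rank d) → Bool) (λ x → linF₂ ident x ≈V̄[ d ] w)
    form-red   : ∀ v w → form B v w 0 ≡ dotF₂ d (linF₂ ident (red v)) (linF₂ ident (red w))
    -- the chosen lifts a_{i,j} = a_{j,i} of v_{{i,j}}
    a       : Fin d → Fin d → Vec₂ (rank d)
    a-sym   : ∀ i j → i ≢ j → a i j ≡ a j i
    a-red   : ∀ i j → i ≢ j → linF₂ ident (red (a i j)) ≈V̄[ d ] vPair i j

  t : Fin d → Fin d → Vec₂ (rank d) → Vec₂ (rank d)
  t i j = transv B (a i j)

  -- t_{a_{i,j}}^2, whose image under ϖ_4 is [i,j]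
  tsq : Fin d → Fin d → Vec₂ (rank d) → Vec₂ (rank d)
  tsq i j v = t i j (t i j v)

-- N^(2): coefficient families c_{i,j} (1 ≤ i < j ≤ 2g+1) with zero row sums

-- indices in {1,…,2g+1} correspond to i : Fin d with toℕ i < 2g+1
InRange : (d : ℕ) → Fin d → Set
InRange d i = toℕ i < suc (rank d)

record N2Coeffs (d : ℕ) : Set where
  field
    c        : Fin d → Fin d → Bool
    c-sym    : ∀ i j → c i j ≡ c j i
    c-diag   : ∀ i → c i i ≡ false
    c-range  : ∀ i j → ¬ InRange d i → c i j ≡ false
    c-rowsum : ∀ i → InRange d i → xorSum d (c i) ≡ false

pairs : (d : ℕ) → List (Fin d × Fin d)
pairs d = concatMap (λ i → map (λ j → (i , j)) (filter (λ j → i <? j) (allFin d))) (allFin d)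

-- a representative in Sp(V) of Σ c_{i,j}[i,j]: the product of t_{a_{i,j}}^2 over
-- pairs i < j with c_{i,j} = 1 (the order is irrelevant modulo 4)
N2Rep : {d : ℕ} → Setup d → N2Coeffs d → Vec₂ (rank d) → Vec₂ (rank d)
N2Rep {d} S C = foldr step (λ v → v) (pairs d)
  where
  open Setup S
  open N2Coeffs C
  step : Fin d × Fin d → (Vec₂ (rank d) → Vec₂ (rank d)) → Vec₂ (rank d) → Vec₂ (rank d)
  step (i , j) f v = if c i j then tsq i j (f v) else f v

-- Reduction of 2-adic digits modulo 8 is a ring map φ : ℤ₂ → ℤ/8 turning each
-- t_a into a transvection T_a x = x + ⟪x,a⟫a of the reduced alternating form.
-- (1) Over ℤ/8, T_a T_b T_a = T_b T_a T_b whenever ⟪a,b⟫² = 1; for a = a_{i,j},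
--     b = a_{i,k} the pairing is odd (it is #({i,j} ∩ {i,k}) mod 2) and odd squares are 1.
-- (2) T_a T_b = T_b T_a − μ(⟪·,b⟫a + ⟪·,a⟫b) with μ = ⟪a_{i,j},a_{k,l}⟫ even.  If 4 ∣ μ
--     the factors commute mod 4 (C = 0); otherwise the defect is 4(⟪·,b⟫a + ⟪·,a⟫b).
--     A product of squares t_{a_{p,q}}² is v ↦ v + 2∑c_{p,q}⟪v,a_{p,q}⟫a_{p,q} mod 4, so C
--     only has to satisfy a congruence mod 2, which is checked in V̄ through the injective
--     identification V/2V ≅ V̄: there it reads ∑_{p<q} c_{p,q}(X_p+X_q)v_{p,q} =
--     (X_k+X_l)v_{i,j} + (X_i+X_j)v_{k,l}, solved by c = v_{i,j}v_{k,l}ᵀ + v_{k,l}v_{i,j}ᵀ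
--     (v_{k,l} replaced by 1+v_{i,j}+v_{k,l} when it meets the index outside {1,…,2g+1}).
module Submission where

open import Level using (0ℓ)
open import Function using (_∘_; id)
open import Data.Bool using (Bool; true; false; not; _∧_; _xor_; if_then_else_)
open import Data.Bool.Properties
  using (xor-∧-commutativeRing; xor-comm; xor-assoc; xor-same; xor-identityʳ; ∧-comm; ∧-assoc;
         ∧-zeroʳ; ∧-identityʳ; ∧-distribˡ-xor; ∧-distribʳ-xor)
  renaming (_≟_ to _≟ᵇ_)
open import Data.Empty using (⊥-elim)
open import Data.Maybe using (nothing)
open import Data.Nat as ℕ using (ℕ; zero; suc; _≤_; s≤s; z≤n)
open import Data.Nat.Properties using (*-comm; ≤-antisym; ≤-pred; ≮⇒≥)
import Relation.Binary.Reasoning.Setoid as SetoidReasoning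
open import Data.Nat.DivMod using (_mod_; m*n/n≡m; m/n≡1+[m∸n]/n; m*n%n≡0)
open import Data.Fin using (Fin; zero; suc; toℕ; fromℕ; #_; _<?_)
open import Data.Fin.Properties using (all?; _≟_; <-cmp; <-asym; toℕ<n; toℕ-injective; toℕ-fromℕ)
open import Data.List using (List; []; _∷_; foldr; _++_; map; filter; concatMap; allFin; tabulate)
open import Data.Product using (Σ; _×_; _,_; proj₁; proj₂)
open import Data.Sum using (_⊎_; inj₁; inj₂)
open import Relation.Nullary using (Dec; yes; no; does; ¬_; map′; _×-dec_; _⊎-dec_; _→-dec_)
open import Relation.Nullary.Decidable using (⌊_⌋; from-yes; dec-true; dec-false; dec⇒maybe)
open import Relation.Unary using (Decidable)
open import Relation.Binary using (Setoid)
open import Relation.Binary.Definitions using (tri<; tri≈; tri>)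
open import Relation.Binary.PropositionalEquality
open import Algebra.Bundles using (CommutativeRing)
open import Algebra.Structures using (IsCommutativeRing)
open import Tactic.RingSolver using (solve-∀)
open import Tactic.RingSolver.Core.AlmostCommutativeRing using (AlmostCommutativeRing; fromCommutativeRing)
open import Defs

module RingSums (R : CommutativeRing 0ℓ 0ℓ)
                (≈⇒≡ : ∀ {x y} → CommutativeRing._≈_ R x y → x ≡ y) where

  ring : AlmostCommutativeRing 0ℓ 0ℓ
  ring = fromCommutativeRing R (λ _ → nothing)

  open AlmostCommutativeRing ring
    using (Carrier; _≈_; _+_; _*_; -_; 0#; +-identityˡ; +-identityʳ; +-assoc; zeroʳ; -‿+-comm)
  open CommutativeRing R using (-‿inverseʳ)
  open import Algebra.Properties.Ring (CommutativeRing.ring R) using (-0#≈0#)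

  ∑ : {X : Set} → List X → (X → Carrier) → Carrier
  ∑ L f = foldr (λ p acc → f p + acc) 0# L

  module _ {X : Set} where

    ∑-cong : (L : List X) {f g : X → Carrier} → (∀ p → f p ≡ g p) → ∑ L f ≡ ∑ L g
    ∑-cong []      f≡g = refl
    ∑-cong (p ∷ L) f≡g = cong₂ _+_ (f≡g p) (∑-cong L f≡g)

    ∑-0 : (L : List X) → ∑ L (λ _ → 0#) ≡ 0#
    ∑-0 []      = refl
    ∑-0 (p ∷ L) = trans (cong (0# +_) (∑-0 L)) (≈⇒≡ (+-identityʳ 0#))

    ∑-+ : (L : List X) (f g : X → Carrier) → ∑ L (λ p → f p + g p) ≡ ∑ L f + ∑ L g
    ∑-+ []      f g = sym (≈⇒≡ (+-identityʳ 0#))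
    ∑-+ (p ∷ L) f g = trans (cong ((f p + g p) +_) (∑-+ L f g)) (≈⇒≡ (interchange (f p) (g p) _ _))
      where
      interchange : ∀ a b c d → (a + b) + (c + d) ≈ (a + c) + (b + d)
      interchange = solve-∀ ring

    ∑-*ˡ : (L : List X) (c : Carrier) (f : X → Carrier) → ∑ L (λ p → c * f p) ≡ c * ∑ L f
    ∑-*ˡ []      c f = sym (≈⇒≡ (zeroʳ c))
    ∑-*ˡ (p ∷ L) c f = trans (cong (c * f p +_) (∑-*ˡ L c f)) (≈⇒≡ (factor c (f p) _))
      where
      factor : ∀ a b c → a * b + a * c ≈ a * (b + c)
      factor = solve-∀ ring

    ∑-neg : (L : List X) (f : X → Carrier) → ∑ L (λ p → - f p) ≡ - ∑ L f
    ∑-neg []      f = sym (≈⇒≡ -0#≈0#)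
    ∑-neg (p ∷ L) f = trans (cong (- f p +_) (∑-neg L f)) (≈⇒≡ (-‿+-comm (f p) (∑ L f)))

    ∑-++ : (L K : List X) (f : X → Carrier) → ∑ (L ++ K) f ≡ ∑ L f + ∑ K f
    ∑-++ []      K f = sym (≈⇒≡ (+-identityˡ (∑ K f)))
    ∑-++ (p ∷ L) K f = trans (cong (f p +_) (∑-++ L K f)) (sym (≈⇒≡ (+-assoc (f p) _ _)))

    ∑-filter : {P : X → Set} (P? : Decidable P) (L : List X) (f : X → Carrier) →
               ∑ (filter P? L) f ≡ ∑ L (λ p → if does (P? p) then f p else 0#)
    ∑-filter P? []      f = refl
    ∑-filter P? (p ∷ L) f with does (P? p)
    ... | true  = cong (f p +_) (∑-filter P? L f)
    ... | false = trans (∑-filter P? L f) (sym (≈⇒≡ (+-identityˡ _)))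

  module _ {X Y : Set} where

    ∑-swap : (L : List X) (K : List Y) (f : X → Y → Carrier) →
             ∑ L (λ p → ∑ K (f p)) ≡ ∑ K (λ q → ∑ L (λ p → f p q))
    ∑-swap []      K f = sym (∑-0 K)
    ∑-swap (p ∷ L) K f =
      trans (cong (∑ K (f p) +_) (∑-swap L K f)) (sym (∑-+ K (f p) (λ q → ∑ L (λ p′ → f p′ q))))

    ∑-map : (h : X → Y) (L : List X) (f : Y → Carrier) → ∑ (map h L) f ≡ ∑ L (f ∘ h)
    ∑-map h []      f = refl
    ∑-map h (p ∷ L) f = cong (f (h p) +_) (∑-map h L f)

    ∑-concatMap : (h : X → List Y) (L : List X) (f : Y → Carrier) →
                  ∑ (concatMap h L) f ≡ ∑ L (λ p → ∑ (h p) f)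
    ∑-concatMap h []      f = refl
    ∑-concatMap h (p ∷ L) f = trans (∑-++ (h p) (concatMap h L) f) (cong (∑ (h p) f +_) (∑-concatMap h L f))

  ∑-allFin-suc : (n : ℕ) (f : Fin (suc n) → Carrier) → ∑ (allFin (suc n)) f ≡ f zero + ∑ (allFin n) (f ∘ suc)
  ∑-allFin-suc n f = cong (f zero +_) (∑-tabulate n suc f)
    where
    ∑-tabulate : ∀ {Y : Set} n (h : Fin n → Y) (g : Y → Carrier) → ∑ (tabulate h) g ≡ ∑ (allFin n) (g ∘ h)
    ∑-tabulate zero    h g = refl
    ∑-tabulate (suc n) h g = cong (g (h zero) +_) (trans (∑-tabulate n (h ∘ suc) g) (sym (∑-tabulate n suc (g ∘ h))))

  ∑-alternating : {X : Set} (L : List X) (f : X → X → Carrier) →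
                  (∀ p → f p p ≡ 0#) → (∀ p q → f p q ≡ - f q p) → ∑ L (λ p → ∑ L (f p)) ≡ 0#
  ∑-alternating []      f diag anti = refl
  ∑-alternating (p ∷ L) f diag anti = begin
    (f p p + ∑ L (f p)) + ∑ L (λ q → f q p + ∑ L (f q))
      ≡⟨ cong₂ (λ a b → (a + ∑ L (f p)) + b) (diag p) (∑-+ L (λ q → f q p) (λ q → ∑ L (f q))) ⟩
    (0# + ∑ L (f p)) + (∑ L (λ q → f q p) + ∑ L (λ q → ∑ L (f q)))
      ≡⟨ cong₂ (λ a b → (0# + ∑ L (f p)) + (a + b)) (trans (∑-cong L (λ q → anti q p)) (∑-neg L (f p))) (∑-alternating L f diag anti) ⟩
    (0# + ∑ L (f p)) + (- ∑ L (f p) + 0#)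
      ≡⟨ cong₂ _+_ (≈⇒≡ (+-identityˡ _)) (≈⇒≡ (+-identityʳ _)) ⟩
    ∑ L (f p) + - ∑ L (f p)
      ≡⟨ ≈⇒≡ (-‿inverseʳ _) ⟩
    0# ∎
    where open ≡-Reasoning

-- ℤ/8, as the residues Fin 8.  Its laws are finite statements, checked by
-- exhaustive evaluation (from-yes of a decision over all elements).
ℤ₈ : Set
ℤ₈ = Fin 8

infixl 6 _+_
infixl 7 _*_
infix  8 -_

_+_ _*_ : ℤ₈ → ℤ₈ → ℤ₈
a + b = (toℕ a ℕ.+ toℕ b) mod 8
a * b = (toℕ a ℕ.* toℕ b) mod 8

-_ : ℤ₈ → ℤ₈
- a = (8 ℕ.∸ toℕ a) mod 8

ℤ₈-isCommutativeRing : IsCommutativeRing _≡_ _+_ _*_ -_ (# 0) (# 1)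
ℤ₈-isCommutativeRing = record
  { isRing = record
    { +-isAbelianGroup = record
      { isGroup = record
        { isMonoid = record
          { isSemigroup = record
            { isMagma = record { isEquivalence = isEquivalence ; ∙-cong = cong₂ _+_ }
            ; assoc = from-yes (all? λ a → all? λ b → all? λ c → (a + b) + c ≟ a + (b + c)) }
          ; identity = from-yes (all? λ a → # 0 + a ≟ a) , from-yes (all? λ a → a + # 0 ≟ a) }
        ; inverse = from-yes (all? λ a → - a + a ≟ # 0) , from-yes (all? λ a → a + - a ≟ # 0)
        ; ⁻¹-cong = cong -_ }
      ; comm = from-yes (all? λ a → all? λ b → a + b ≟ b + a) }
    ; *-cong = cong₂ _*_
    ; *-assoc = from-yes (all? λ a → all? λ b → all? λ c → (a * b) * c ≟ a * (b * c))
    ; *-identity = from-yes (all? λ a → # 1 * a ≟ a) , from-yes (all? λ a → a * # 1 ≟ a)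
    ; distrib = from-yes (all? λ a → all? λ b → all? λ c → a * (b + c) ≟ a * b + a * c)
              , from-yes (all? λ a → all? λ b → all? λ c → (b + c) * a ≟ b * a + c * a) }
  ; *-comm = from-yes (all? λ a → all? λ b → a * b ≟ b * a) }

ℤ₈-commutativeRing : CommutativeRing 0ℓ 0ℓ
ℤ₈-commutativeRing = record { isCommutativeRing = ℤ₈-isCommutativeRing }

-- ℤ/8 for the ring solver; the zero test lets it cancel constants such as 8 = 0
ℤ₈-ring : AlmostCommutativeRing 0ℓ 0ℓ
ℤ₈-ring = fromCommutativeRing ℤ₈-commutativeRing (λ x → dec⇒maybe (# 0 ≟ x))

module ℤ₈Σ = RingSums ℤ₈-commutativeRing id
open ℤ₈Σ using (∑; ∑-cong; ∑-0; ∑-+; ∑-*ˡ; ∑-neg; ∑-swap; ∑-alternating)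

parity : ℤ₈ → Bool
parity a = bit 0 (toℕ a)

parity-+ : ∀ a b → parity (a + b) ≡ parity a xor parity b
parity-+ = from-yes (all? λ a → all? λ b → parity (a + b) ≟ᵇ parity a xor parity b)

parity-* : ∀ a b → parity (a * b) ≡ parity a ∧ parity b
parity-* = from-yes (all? λ a → all? λ b → parity (a * b) ≟ᵇ parity a ∧ parity b)

four-parity : ∀ a b → parity a ≡ parity b → # 4 * a ≡ # 4 * b
four-parity = from-yes (all? λ a → all? λ b → (parity a ≟ᵇ parity b) →-dec (# 4 * a ≟ # 4 * b))

odd-square : ∀ a → parity a ≡ true → a * a ≡ # 1
odd-square = from-yes (all? λ a → (parity a ≟ᵇ true) →-dec (a * a ≟ # 1))

even-double : ∀ a → parity a ≡ false → (# 2 * a ≡ # 0) ⊎ (# 2 * a ≡ # 4)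
even-double = from-yes (all? λ a → (parity a ≟ᵇ false) →-dec ((# 2 * a ≟ # 0) ⊎-dec (# 2 * a ≟ # 4)))

four-from-two : ∀ a b s → # 2 * a ≡ # 2 * b + # 4 * s → # 4 * a ≡ # 4 * b
four-from-two a b s 2a≡2b+4s = begin
  # 4 * a                    ≡⟨ double a ⟩
  # 2 * (# 2 * a)            ≡⟨ cong (# 2 *_) 2a≡2b+4s ⟩
  # 2 * (# 2 * b + # 4 * s)  ≡⟨ eight-vanishes b s ⟩
  # 4 * b                    ∎
  where
  open ≡-Reasoning
  double : ∀ a → # 4 * a ≡ # 2 * (# 2 * a)
  double = solve-∀ ℤ₈-ring
  eight-vanishes : ∀ b s → # 2 * (# 2 * b + # 4 * s) ≡ # 4 * b
  eight-vanishes = solve-∀ ℤ₈-ring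

-- statements about 2-adic integers that only involve their three lowest digits
-- are checked on all 2⁶ (resp. 2³) combinations of those digits
∀Bool? : {P : Bool → Set} → Decidable P → Dec (∀ b → P b)
∀Bool? P? = map′ (λ (f , t) → λ { false → f ; true → t }) (λ h → h false , h true) (P? false ×-dec P? true)

lowDigits : Bool → Bool → Bool → ℤ₂
lowDigits b₀ b₁ b₂ 0 = b₀
lowDigits b₀ b₁ b₂ 1 = b₁
lowDigits b₀ b₁ b₂ 2 = b₂
lowDigits b₀ b₁ b₂ _ = false

-- φ is kept opaque so that later goals never unfold the digit arithmetic
opaque
  φ : ℤ₂ → ℤ₈
  φ x = trunc 3 x mod 8

  φ-+ : ∀ x y → φ (x +₂ y) ≡ φ x + φ y
  φ-+ x y = from-yes (∀Bool? λ a₀ → ∀Bool? λ a₁ → ∀Bool? λ a₂ → ∀Bool? λ b₀ → ∀Bool? λ b₁ → ∀Bool? λ b₂ →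
    let x′ = lowDigits a₀ a₁ a₂ ; y′ = lowDigits b₀ b₁ b₂ in φ (x′ +₂ y′) ≟ φ x′ + φ y′)
    (x 0) (x 1) (x 2) (y 0) (y 1) (y 2)

  φ-* : ∀ x y → φ (x *₂ y) ≡ φ x * φ y
  φ-* x y = from-yes (∀Bool? λ a₀ → ∀Bool? λ a₁ → ∀Bool? λ a₂ → ∀Bool? λ b₀ → ∀Bool? λ b₁ → ∀Bool? λ b₂ →
    let x′ = lowDigits a₀ a₁ a₂ ; y′ = lowDigits b₀ b₁ b₂ in φ (x′ *₂ y′) ≟ φ x′ * φ y′)
    (x 0) (x 1) (x 2) (y 0) (y 1) (y 2)

  φ-neg : ∀ x → φ (-₂ x) ≡ - φ x
  φ-neg x = from-yes (∀Bool? λ a₀ → ∀Bool? λ a₁ → ∀Bool? λ a₂ →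
    let x′ = lowDigits a₀ a₁ a₂ in φ (-₂ x′) ≟ - φ x′)
    (x 0) (x 1) (x 2)

  φ-0 : φ 0ℤ₂ ≡ # 0
  φ-0 = refl

  parity-φ : ∀ x → parity (φ x) ≡ x 0
  parity-φ x = from-yes (∀Bool? λ a₀ → ∀Bool? λ a₁ → ∀Bool? λ a₂ →
    parity (φ (lowDigits a₀ a₁ a₂)) ≟ᵇ a₀)
    (x 0) (x 1) (x 2)

  φ-trunc₃ : ∀ x y → φ x ≡ φ y → trunc 3 x ≡ trunc 3 y
  φ-trunc₃ x y = from-yes (∀Bool? λ a₀ → ∀Bool? λ a₁ → ∀Bool? λ a₂ → ∀Bool? λ b₀ → ∀Bool? λ b₁ → ∀Bool? λ b₂ →
    let x′ = lowDigits a₀ a₁ a₂ ; y′ = lowDigits b₀ b₁ b₂ in (φ x′ ≟ φ y′) →-dec (trunc 3 x′ ℕ.≟ trunc 3 y′))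
    (x 0) (x 1) (x 2) (y 0) (y 1) (y 2)

  twiceφ-trunc₂ : ∀ x y → # 2 * φ x ≡ # 2 * φ y → trunc 2 x ≡ trunc 2 y
  twiceφ-trunc₂ x y = from-yes (∀Bool? λ a₀ → ∀Bool? λ a₁ → ∀Bool? λ a₂ → ∀Bool? λ b₀ → ∀Bool? λ b₁ → ∀Bool? λ b₂ →
    let x′ = lowDigits a₀ a₁ a₂ ; y′ = lowDigits b₀ b₁ b₂ in (# 2 * φ x′ ≟ # 2 * φ y′) →-dec (trunc 2 x′ ℕ.≟ trunc 2 y′))
    (x 0) (x 1) (x 2) (y 0) (y 1) (y 2)

φ-∑ : {X : Set} (L : List X) (f : X → ℤ₂) → φ (foldr (λ p acc → f p +₂ acc) 0ℤ₂ L) ≡ ∑ L (φ ∘ f)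
φ-∑ []      f = φ-0
φ-∑ (p ∷ L) f = trans (φ-+ (f p) (foldr (λ p acc → f p +₂ acc) 0ℤ₂ L)) (cong (φ (f p) +_) (φ-∑ L f))

module Forms {r : ℕ} (M : Fin r → Fin r → ℤ₈) where

  V₈ : Set
  V₈ = Fin r → ℤ₈

  row : V₈ → V₈ → Fin r → ℤ₈
  row x y m = ∑ (allFin r) (λ n → (x m * M m n) * y n)

  ⟪_,_⟫ : V₈ → V₈ → ℤ₈
  ⟪ x , y ⟫ = ∑ (allFin r) (row x y)

  T : V₈ → V₈ → V₈
  T a x m = x m + ⟪ x , a ⟫ * a m

  ⟪⟫-congˡ : ∀ {x x′} y → (∀ m → x m ≡ x′ m) → ⟪ x , y ⟫ ≡ ⟪ x′ , y ⟫
  ⟪⟫-congˡ y x≡x′ = ∑-cong (allFin r) (λ m → ∑-cong (allFin r) (λ n → cong (λ c → (c * M m n) * y n) (x≡x′ m)))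

  T-cong : ∀ a {x x′} → (∀ m → x m ≡ x′ m) → ∀ m → T a x m ≡ T a x′ m
  T-cong a x≡x′ m = cong₂ (λ c k → c + k * a m) (x≡x′ m) (⟪⟫-congˡ a x≡x′)

  ⟪⟫-+ˡ : ∀ x y z → ⟪ (λ m → x m + y m) , z ⟫ ≡ ⟪ x , z ⟫ + ⟪ y , z ⟫
  ⟪⟫-+ˡ x y z = trans (∑-cong (allFin r) split-row) (∑-+ (allFin r) (row x z) (row y z))
    where
    expand : ∀ a b c d → ((a + b) * c) * d ≡ (a * c) * d + (b * c) * d
    expand = solve-∀ ℤ₈-ring
    split-row : ∀ m → row (λ m → x m + y m) z m ≡ row x z m + row y z m
    split-row m = trans (∑-cong (allFin r) (λ n → expand (x m) (y m) (M m n) (z n)))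
                        (∑-+ (allFin r) (λ n → (x m * M m n) * z n) (λ n → (y m * M m n) * z n))

  ⟪⟫-*ˡ : ∀ k x z → ⟪ (λ m → k * x m) , z ⟫ ≡ k * ⟪ x , z ⟫
  ⟪⟫-*ˡ k x z = trans (∑-cong (allFin r) scale-row) (∑-*ˡ (allFin r) k (row x z))
    where
    pull : ∀ k a c d → ((k * a) * c) * d ≡ k * ((a * c) * d)
    pull = solve-∀ ℤ₈-ring
    scale-row : ∀ m → row (λ m → k * x m) z m ≡ k * row x z m
    scale-row m = trans (∑-cong (allFin r) (λ n → pull k (x m) (M m n) (z n)))
                        (∑-*ˡ (allFin r) k (λ n → (x m * M m n) * z n))

  ⟪T⟫ : ∀ c y z → ⟪ T c y , z ⟫ ≡ ⟪ y , z ⟫ + ⟪ y , c ⟫ * ⟪ c , z ⟫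
  ⟪T⟫ c y z = trans (⟪⟫-+ˡ y (λ m → ⟪ y , c ⟫ * c m) z) (cong (⟪ y , z ⟫ +_) (⟪⟫-*ˡ ⟪ y , c ⟫ c z))

  module Alternating (M-diag : ∀ m → M m m ≡ # 0) (M-anti : ∀ m n → M m n ≡ - M n m) where

    private
      entry-anti : ∀ (x y : V₈) m n → (x m * M m n) * y n ≡ - ((y n * M n m) * x m)
      entry-anti x y m n = trans (cong (λ c → (x m * c) * y n) (M-anti m n)) (flip (x m) (y n) (M n m))
        where
        flip : ∀ a b c → (a * - c) * b ≡ - ((b * c) * a)
        flip = solve-∀ ℤ₈-ring

    ⟪⟫-antisym : ∀ x y → ⟪ y , x ⟫ ≡ - ⟪ x , y ⟫
    ⟪⟫-antisym x y = begin
      ⟪ y , x ⟫                                                        ≡⟨ ∑-swap (allFin r) (allFin r) (λ m n → (y m * M m n) * x n) ⟩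
      ∑ (allFin r) (λ n → ∑ (allFin r) (λ m → (y m * M m n) * x n))   ≡⟨ ∑-cong (allFin r) (λ n → ∑-cong (allFin r) (λ m → entry-anti y x m n)) ⟩
      ∑ (allFin r) (λ n → ∑ (allFin r) (λ m → - ((x n * M n m) * y m))) ≡⟨ ∑-cong (allFin r) (λ n → ∑-neg (allFin r) (λ m → (x n * M n m) * y m)) ⟩
      ∑ (allFin r) (λ n → - row x y n)                                 ≡⟨ ∑-neg (allFin r) (row x y) ⟩
      - ⟪ x , y ⟫                                                      ∎
      where open ≡-Reasoning

    ⟪⟫-self : ∀ x → ⟪ x , x ⟫ ≡ # 0
    ⟪⟫-self x = ∑-alternating (allFin r) (λ m n → (x m * M m n) * x n)
      (λ m → trans (cong (λ c → (x m * c) * x m) (M-diag m)) (by-zero (x m)))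
      (entry-anti x x)
      where
      by-zero : ∀ a → (a * # 0) * a ≡ # 0
      by-zero = solve-∀ ℤ₈-ring

    ⟪T⟫-self : ∀ a x → ⟪ T a x , a ⟫ ≡ ⟪ x , a ⟫
    ⟪T⟫-self a x = trans (⟪T⟫ a x a) (trans (cong (λ s → ⟪ x , a ⟫ + ⟪ x , a ⟫ * s) (⟪⟫-self a)) (drop-zero ⟪ x , a ⟫))
      where
      drop-zero : ∀ p → p + p * # 0 ≡ p
      drop-zero = solve-∀ ℤ₈-ring

    T-twice : ∀ a x m → T a (T a x) m ≡ x m + # 2 * (⟪ x , a ⟫ * a m)
    T-twice a x m = trans (cong (λ s → T a x m + s * a m) (⟪T⟫-self a x)) (collect (x m) ⟪ x , a ⟫ (a m))
      where
      collect : ∀ x α a → (x + α * a) + α * a ≡ x + # 2 * (α * a)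
      collect = solve-∀ ℤ₈-ring

    ⟪TT⟫-right : ∀ a b x → ⟪ T b (T a x) , b ⟫ ≡ ⟪ x , b ⟫ + ⟪ x , a ⟫ * ⟪ a , b ⟫
    ⟪TT⟫-right a b x = trans (⟪T⟫-self b (T a x)) (⟪T⟫ a x b)

    ⟪TT⟫-left : ∀ a b x → ⟪ T b (T a x) , a ⟫ ≡ ⟪ x , a ⟫ + - ((⟪ x , b ⟫ + ⟪ x , a ⟫ * ⟪ a , b ⟫) * ⟪ a , b ⟫)
    ⟪TT⟫-left a b x = begin
      ⟪ T b (T a x) , a ⟫                                            ≡⟨ ⟪T⟫ b (T a x) a ⟩
      ⟪ T a x , a ⟫ + ⟪ T a x , b ⟫ * ⟪ b , a ⟫                      ≡⟨ cong₂ (λ p q → p + q * ⟪ b , a ⟫) (⟪T⟫-self a x) (⟪T⟫ a x b) ⟩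
      ⟪ x , a ⟫ + (⟪ x , b ⟫ + ⟪ x , a ⟫ * ⟪ a , b ⟫) * ⟪ b , a ⟫    ≡⟨ cong (λ s → ⟪ x , a ⟫ + (⟪ x , b ⟫ + ⟪ x , a ⟫ * ⟪ a , b ⟫) * s) (⟪⟫-antisym a b) ⟩
      ⟪ x , a ⟫ + (⟪ x , b ⟫ + ⟪ x , a ⟫ * ⟪ a , b ⟫) * - ⟪ a , b ⟫  ≡⟨ pull-neg ⟪ x , a ⟫ (⟪ x , b ⟫ + ⟪ x , a ⟫ * ⟪ a , b ⟫) ⟪ a , b ⟫ ⟩
      ⟪ x , a ⟫ + - ((⟪ x , b ⟫ + ⟪ x , a ⟫ * ⟪ a , b ⟫) * ⟪ a , b ⟫) ∎
      where
      open ≡-Reasoning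
      pull-neg : ∀ p q μ → p + q * - μ ≡ p + - (q * μ)
      pull-neg = solve-∀ ℤ₈-ring

    commutator : ∀ a b x m →
      T a (T b x) m ≡ T b (T a x) m + - (⟪ a , b ⟫ * (⟪ x , b ⟫ * a m + ⟪ x , a ⟫ * b m))
    commutator a b x m = begin
      T a (T b x) m
        ≡⟨ cong (λ s → T b x m + s * a m) (trans (⟪T⟫ b x a) (cong (λ s → α + β * s) (⟪⟫-antisym a b))) ⟩
      (x m + β * b m) + (α + β * - μ) * a m
        ≡⟨ reorder (x m) (a m) (b m) α β μ ⟩
      ((x m + α * a m) + (β + α * μ) * b m) + - (μ * (β * a m + α * b m))
        ≡⟨ cong (λ s → ((x m + α * a m) + s * b m) + - (μ * (β * a m + α * b m))) (sym (⟪T⟫ a x b)) ⟩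
      T b (T a x) m + - (μ * (β * a m + α * b m)) ∎
      where
      open ≡-Reasoning
      α = ⟪ x , a ⟫
      β = ⟪ x , b ⟫
      μ = ⟪ a , b ⟫
      reorder : ∀ x a b α β μ → (x + β * b) + (α + β * - μ) * a ≡ ((x + α * a) + (β + α * μ) * b) + - (μ * (β * a + α * b))
      reorder = solve-∀ ℤ₈-ring

    -- T_a T_b T_a, in coordinates, through the scalars ⟪x,a⟫, ⟪x,b⟫, ⟪a,b⟫
    braidPoly : ℤ₈ → ℤ₈ → ℤ₈ → ℤ₈ → ℤ₈ → ℤ₈ → ℤ₈
    braidPoly x a b α β μ = ((x + α * a) + (β + α * μ) * b) + (α + - ((β + α * μ) * μ)) * a

    T³ : ∀ a b x m → T a (T b (T a x)) m ≡ braidPoly (x m) (a m) (b m) ⟪ x , a ⟫ ⟪ x , b ⟫ ⟪ a , b ⟫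
    T³ a b x m = cong₂ (λ p q → ((x m + ⟪ x , a ⟫ * a m) + p * b m) + q * a m) (⟪T⟫ a x b) (⟪TT⟫-left a b x)

    -- the braid relation, for ⟪a,b⟫² = 1: the two sides differ by (1 − ⟪a,b⟫²)(⟪x,a⟫a − ⟪x,b⟫b)
    braid : ∀ a b → ⟪ a , b ⟫ * ⟪ a , b ⟫ ≡ # 1 → ∀ x m → T a (T b (T a x)) m ≡ T b (T a (T b x)) m
    braid a b μ²≡1 x m = begin
      T a (T b (T a x)) m
        ≡⟨ T³ a b x m ⟩
      braidPoly (x m) (a m) (b m) α β μ
        ≡⟨ exchange (x m) (a m) (b m) α β μ ⟩
      braidPoly (x m) (b m) (a m) β α (- μ) + (α * a m + - (β * b m)) * (# 1 + - (μ * μ))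
        ≡⟨ cong (λ s → braidPoly (x m) (b m) (a m) β α (- μ) + (α * a m + - (β * b m)) * (# 1 + - s)) μ²≡1 ⟩
      braidPoly (x m) (b m) (a m) β α (- μ) + (α * a m + - (β * b m)) * (# 1 + - # 1)
        ≡⟨ vanish (braidPoly (x m) (b m) (a m) β α (- μ)) (α * a m + - (β * b m)) ⟩
      braidPoly (x m) (b m) (a m) β α (- μ)
        ≡⟨ cong (braidPoly (x m) (b m) (a m) β α) (sym (⟪⟫-antisym a b)) ⟩
      braidPoly (x m) (b m) (a m) β α ⟪ b , a ⟫
        ≡⟨ sym (T³ b a x m) ⟩
      T b (T a (T b x)) m ∎
      where
      open ≡-Reasoning
      α = ⟪ x , a ⟫
      β = ⟪ x , b ⟫
      μ = ⟪ a , b ⟫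
      -- braidPoly unfolded, so that the ring solver sees the polynomials
      exchange : ∀ x a b α β μ → ((x + α * a) + (β + α * μ) * b) + (α + - ((β + α * μ) * μ)) * a
                               ≡ (((x + β * b) + (α + β * - μ) * a) + (β + - ((α + β * - μ) * - μ)) * b)
                                 + (α * a + - (β * b)) * (# 1 + - (μ * μ))
      exchange = solve-∀ ℤ₈-ring
      vanish : ∀ p q → p + q * (# 1 + - # 1) ≡ p
      vanish = solve-∀ ℤ₈-ring

-- 𝔽₂ = (Bool, xor, ∧); its sums ⨁ include xorSum, dotF₂ and linF₂ of Defs
module 𝔽₂ = RingSums xor-∧-commutativeRing id
open 𝔽₂ using ()
  renaming (∑ to ⨁; ∑-cong to ⨁-cong; ∑-0 to ⨁-false; ∑-+ to ⨁-xor; ∑-*ˡ to ⨁-∧; ∑-swap to ⨁-swap;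
            ∑-map to ⨁-map; ∑-concatMap to ⨁-concatMap; ∑-filter to ⨁-filter; ∑-allFin-suc to ⨁-allFin-suc)

𝔽₂-ring : AlmostCommutativeRing _ _
𝔽₂-ring = fromCommutativeRing xor-∧-commutativeRing (λ b → dec⇒maybe (false ≟ᵇ b))

parity-∑ : {X : Set} (L : List X) (f : X → ℤ₈) → parity (∑ L f) ≡ ⨁ L (parity ∘ f)
parity-∑ []      f = refl
parity-∑ (p ∷ L) f = trans (parity-+ (f p) (∑ L f)) (cong (parity (f p) xor_) (parity-∑ L f))

δ : ∀ {n} → Fin n → Fin n → Bool
δ x i = ⌊ x ≟ i ⌋

δ-refl : ∀ {n} (i : Fin n) → δ i i ≡ true
δ-refl i with i ≟ i
... | yes _  = refl
... | no i≢i = ⊥-elim (i≢i refl)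

δ-≢ : ∀ {n} {x i : Fin n} → x ≢ i → δ x i ≡ false
δ-≢ {x = x} {i} x≢i with x ≟ i
... | yes x≡i = ⊥-elim (x≢i x≡i)
... | no _    = refl

δ-sym : ∀ {n} (x i : Fin n) → δ x i ≡ δ i x
δ-sym x i with x ≟ i | i ≟ x
... | yes _   | yes _   = refl
... | no _    | no _    = refl
... | yes x≡i | no i≢x  = ⊥-elim (i≢x (sym x≡i))
... | no x≢i  | yes i≡x = ⊥-elim (x≢i (sym i≡x))

δ-suc : ∀ {n} (x i : Fin n) → δ (suc x) (suc i) ≡ δ x i
δ-suc x i with x ≟ i
... | yes _ = refl
... | no _  = refl

⨁-δ : ∀ n (i : Fin n) (g : Fin n → Bool) → ⨁ (allFin n) (λ x → δ x i ∧ g x) ≡ g i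
⨁-δ (suc n) zero    g = trans (⨁-allFin-suc n (λ x → δ x zero ∧ g x)) (trans (cong (g zero xor_) (⨁-false (allFin n))) (xor-identityʳ (g zero)))
⨁-δ (suc n) (suc i) g = trans (⨁-allFin-suc n (λ x → δ x (suc i) ∧ g x)) (trans (⨁-cong (allFin n) (λ x → cong (_∧ g (suc x)) (δ-suc x i))) (⨁-δ n i (g ∘ suc)))

⨁-δ′ : ∀ n (i : Fin n) → ⨁ (allFin n) (λ x → δ x i) ≡ true
⨁-δ′ n i = trans (⨁-cong (allFin n) (λ x → sym (∧-identityʳ (δ x i)))) (⨁-δ n i (λ _ → true))

⨁-true : ∀ d → d ℕ.% 2 ≡ 0 → ⨁ (allFin d) (λ _ → true) ≡ false
⨁-true zero          _    = refl
⨁-true (suc zero)    ()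
⨁-true (suc (suc d)) even =
  trans (⨁-allFin-suc (suc d) (λ _ → true)) (trans (cong (true xor_) (⨁-allFin-suc d (λ _ → true))) (trans (sym (xor-assoc true true _)) (⨁-true d even)))

module Linear {r d : ℕ} (u : Fin r → Fin d → Bool) where

  linF₂-xor : ∀ x y i → linF₂ u (λ m → x m xor y m) i ≡ linF₂ u x i xor linF₂ u y i
  linF₂-xor x y i = trans (⨁-cong (allFin r) (λ m → ∧-distribʳ-xor (u m i) (x m) (y m)))
                          (⨁-xor (allFin r) (λ m → x m ∧ u m i) (λ m → y m ∧ u m i))

  linF₂-∧ : ∀ t y i → linF₂ u (λ m → t ∧ y m) i ≡ t ∧ linF₂ u y i
  linF₂-∧ t y i = trans (⨁-cong (allFin r) (λ m → ∧-assoc t (y m) (u m i))) (⨁-∧ (allFin r) t (λ m → y m ∧ u m i))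

  linF₂-⨁ : {X : Set} (L : List X) (y : X → Fin r → Bool) → ∀ i →
            linF₂ u (λ m → ⨁ L (λ p → y p m)) i ≡ ⨁ L (λ p → linF₂ u (y p) i)
  linF₂-⨁ L y i = begin
    ⨁ (allFin r) (λ m → ⨁ L (λ p → y p m) ∧ u m i)
      ≡⟨ ⨁-cong (allFin r) (λ m → trans (∧-comm _ (u m i)) (sym (⨁-∧ L (u m i) (λ p → y p m)))) ⟩
    ⨁ (allFin r) (λ m → ⨁ L (λ p → u m i ∧ y p m))
      ≡⟨ ⨁-swap (allFin r) L (λ m p → u m i ∧ y p m) ⟩
    ⨁ L (λ p → ⨁ (allFin r) (λ m → u m i ∧ y p m))
      ≡⟨ ⨁-cong L (λ p → ⨁-cong (allFin r) (λ m → ∧-comm (u m i) (y p m))) ⟩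
    ⨁ L (λ p → linF₂ u (y p) i) ∎
    where open ≡-Reasoning

  linF₂-W₀ : (∀ m → InW₀ d (u m)) → ∀ x → InW₀ d (linF₂ u x)
  linF₂-W₀ u∈W₀ x = begin
    ⨁ (allFin d) (λ i → ⨁ (allFin r) (λ m → x m ∧ u m i))
      ≡⟨ ⨁-swap (allFin d) (allFin r) (λ i m → x m ∧ u m i) ⟩
    ⨁ (allFin r) (λ m → ⨁ (allFin d) (λ i → x m ∧ u m i))
      ≡⟨ ⨁-cong (allFin r) (λ m → trans (⨁-∧ (allFin d) (x m) (u m)) (trans (cong (x m ∧_) (u∈W₀ m)) (∧-zeroʳ (x m)))) ⟩
    ⨁ (allFin r) (λ _ → false)
      ≡⟨ ⨁-false (allFin r) ⟩
    false ∎
    where open ≡-Reasoning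

-- The indices outside {1,…,2g+1}: none for odd d, only the last for even d

private
  parity-view : ∀ d → (Σ ℕ λ n → d ≡ n ℕ.* 2) ⊎ (Σ ℕ λ n → d ≡ suc (n ℕ.* 2))
  parity-view zero    = inj₁ (0 , refl)
  parity-view (suc d) with parity-view d
  ... | inj₁ (n , d≡2n)   = inj₂ (n , cong suc d≡2n)
  ... | inj₂ (n , d≡2n+1) = inj₁ (suc n , cong suc d≡2n+1)

  half-odd : ∀ n → suc (n ℕ.* 2) ℕ./ 2 ≡ n
  half-odd zero    = refl
  half-odd (suc n) = trans (m/n≡1+[m∸n]/n {suc (suc (suc (n ℕ.* 2)))} {2} (s≤s (s≤s z≤n))) (cong suc (half-odd n))

indexRange : ∀ d → (∀ p → InRange d p) ⊎ (d ℕ.% 2 ≡ 0 × Σ (Fin d) (λ z → ∀ p → ¬ InRange d p → p ≡ z))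
indexRange d with parity-view d
... | inj₂ (n , refl) = inj₁ (λ p → subst (λ q → toℕ p ℕ.< suc q) (trans (*-comm n 2) (cong (2 ℕ.*_) (sym (m*n/n≡m n 2)))) (toℕ<n p))
... | inj₁ (zero , refl) = inj₁ (λ ())
... | inj₁ (suc n , refl) =
  inj₂ (m*n%n≡0 n 2 , fromℕ (suc (n ℕ.* 2)) , λ p out → toℕ-injective (trans (last p out) (sym (toℕ-fromℕ _))))
  where
  last : ∀ (p : Fin (suc n ℕ.* 2)) → ¬ InRange (suc n ℕ.* 2) p → toℕ p ≡ suc (n ℕ.* 2)
  last p out = ≤-antisym (≤-pred (toℕ<n p)) (subst (λ q → suc q ℕ.≤ toℕ p) (trans (cong (2 ℕ.*_) (half-odd n)) (*-comm 2 n)) (≮⇒≥ out))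

module Coordinates (d : ℕ) where

  dot : (Fin d → Bool) → (Fin d → Bool) → Bool
  dot = dotF₂ d

  dot-sym : ∀ u w → dot u w ≡ dot w u
  dot-sym u w = ⨁-cong (allFin d) (λ x → ∧-comm (u x) (w x))

  dot-vPair : ∀ u i j → dot u (vPair i j) ≡ u i xor u j
  dot-vPair u i j = begin
    ⨁ (allFin d) (λ x → u x ∧ (δ x i xor δ x j))
      ≡⟨ ⨁-cong (allFin d) (λ x → trans (∧-distribˡ-xor (u x) (δ x i) (δ x j)) (cong₂ _xor_ (∧-comm (u x) (δ x i)) (∧-comm (u x) (δ x j)))) ⟩
    ⨁ (allFin d) (λ x → (δ x i ∧ u x) xor (δ x j ∧ u x))
      ≡⟨ ⨁-xor (allFin d) (λ x → δ x i ∧ u x) (λ x → δ x j ∧ u x) ⟩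
    ⨁ (allFin d) (λ x → δ x i ∧ u x) xor ⨁ (allFin d) (λ x → δ x j ∧ u x)
      ≡⟨ cong₂ _xor_ (⨁-δ d i u) (⨁-δ d j u) ⟩
    u i xor u j ∎
    where open ≡-Reasoning

  vPair-dot : ∀ u i j → dot (vPair i j) u ≡ u i xor u j
  vPair-dot u i j = trans (dot-sym (vPair i j) u) (dot-vPair u i j)

  vPair-W₀ : ∀ i j → InW₀ d (vPair i j)
  vPair-W₀ i j = trans (⨁-xor (allFin d) (λ x → δ x i) (λ x → δ x j)) (cong₂ _xor_ (⨁-δ′ d i) (⨁-δ′ d j))

  vPair-outside : ∀ {x i j : Fin d} → x ≢ i → x ≢ j → vPair i j x ≡ false
  vPair-outside x≢i x≢j = cong₂ _xor_ (δ-≢ x≢i) (δ-≢ x≢j)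

  vPair-left : ∀ {i j : Fin d} → i ≢ j → vPair i j i ≡ true
  vPair-left {i} i≢j = cong₂ _xor_ (δ-refl i) (δ-≢ i≢j)

  vPair-right : ∀ {i j : Fin d} → i ≢ j → vPair i j j ≡ true
  vPair-right {j = j} i≢j = cong₂ _xor_ (δ-≢ (i≢j ∘ sym)) (δ-refl j)

  -- u ∼ w: u and w represent the same element of V̄, i.e. they differ by a
  -- constant vector, which must be 0 unless d is even
  record _∼_ (u w : Fin d → Bool) : Set where
    constructor shiftBy
    field
      offset      : Bool
      offset-even : offset ≡ true → d ℕ.% 2 ≡ 0
      shifted     : ∀ x → u x ≡ w x xor offset

  infix 4 _∼_

  pointwise : ∀ {u w} → (∀ x → u x ≡ w x) → u ∼ w
  pointwise u≡w = shiftBy false (λ ()) (λ x → trans (u≡w x) (sym (xor-identityʳ _)))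

  private
    even-xor : ∀ e e′ → (e ≡ true → d ℕ.% 2 ≡ 0) → (e′ ≡ true → d ℕ.% 2 ≡ 0) → e xor e′ ≡ true → d ℕ.% 2 ≡ 0
    even-xor true  e′ even _ _ = even refl
    even-xor false e′ _ even′ t = even′ t

  ∼-xor : ∀ {u u′ w w′} → u ∼ u′ → w ∼ w′ → (λ x → u x xor w x) ∼ (λ x → u′ x xor w′ x)
  ∼-xor {u′ = u′} {w′ = w′} (shiftBy e even u≡) (shiftBy e′ even′ w≡) =
    shiftBy (e xor e′) (even-xor e e′ even even′) (λ x → trans (cong₂ _xor_ (u≡ x) (w≡ x)) (regroup (u′ x) e (w′ x) e′))
    where
    regroup : ∀ a b c d → (a xor b) xor (c xor d) ≡ (a xor c) xor (b xor d)
    regroup = solve-∀ 𝔽₂-ring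

  ∼-∧ : ∀ t {u w} → u ∼ w → (λ x → t ∧ u x) ∼ (λ x → t ∧ w x)
  ∼-∧ t {w = w} (shiftBy e even u≡) =
    shiftBy (t ∧ e) (λ te → even (∧-true t e te)) (λ x → trans (cong (t ∧_) (u≡ x)) (∧-distribˡ-xor t (w x) e))
    where
    ∧-true : ∀ a b → a ∧ b ≡ true → b ≡ true
    ∧-true true b eq = eq

  ∼-refl : ∀ {u} → u ∼ u
  ∼-refl = pointwise (λ _ → refl)

  ∼-sym : ∀ {u w} → u ∼ w → w ∼ u
  ∼-sym {u} {w} (shiftBy e even u≡) = shiftBy e even (λ x → trans (sym (cancel (w x) e)) (cong (_xor e) (sym (u≡ x))))
    where
    cancel : ∀ a b → (a xor b) xor b ≡ a
    cancel = solve-∀ 𝔽₂-ring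

  ∼-trans : ∀ {u v w} → u ∼ v → v ∼ w → u ∼ w
  ∼-trans {w = w} (shiftBy e even u≡) (shiftBy e′ even′ v≡) =
    shiftBy (e′ xor e) (even-xor e′ e even′ even) (λ x → trans (u≡ x) (trans (cong (_xor e) (v≡ x)) (xor-assoc (w x) e′ e)))

  ∼-setoid : Setoid _ _
  ∼-setoid = record { Carrier = Fin d → Bool ; _≈_ = _∼_
                    ; isEquivalence = record { refl = ∼-refl ; sym = ∼-sym ; trans = ∼-trans } }

  ∼-⨁ : {X : Set} (L : List X) {F G : X → Fin d → Bool} → (∀ p → F p ∼ G p) →
        (λ x → ⨁ L (λ p → F p x)) ∼ (λ x → ⨁ L (λ p → G p x))
  ∼-⨁ []      F∼G = ∼-refl
  ∼-⨁ (p ∷ L) F∼G = ∼-xor (F∼G p) (∼-⨁ L F∼G)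

  ≈V̄⇒∼ : ∀ {u w} → u ≈V̄[ d ] w → u ∼ w
  ≈V̄⇒∼ (inj₁ u≡w)          = pointwise u≡w
  ≈V̄⇒∼ (inj₂ (even , u≡¬w)) = shiftBy true (λ _ → even) (λ x → trans (u≡¬w x) (not-as-xor _))
    where
    not-as-xor : ∀ b → not b ≡ b xor true
    not-as-xor false = refl
    not-as-xor true  = refl

  ∼⇒≈V̄ : ∀ {u w} → u ∼ w → u ≈V̄[ d ] w
  ∼⇒≈V̄ (shiftBy false _    u≡w) = inj₁ (λ x → trans (u≡w x) (xor-identityʳ _))
  ∼⇒≈V̄ (shiftBy true  even u≡w) = inj₂ (even refl , λ x → trans (u≡w x) (xor-true _))
    where
    xor-true : ∀ b → b xor true ≡ not b
    xor-true false = refl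
    xor-true true  = refl

  dot-∼ : ∀ {u u′} w → u ∼ u′ → InW₀ d w → dot u w ≡ dot u′ w
  dot-∼ {u} {u′} w (shiftBy e _ u≡) w∈W₀ = begin
    ⨁ (allFin d) (λ x → u x ∧ w x)
      ≡⟨ ⨁-cong (allFin d) (λ x → trans (cong (_∧ w x) (u≡ x)) (∧-distribʳ-xor (w x) (u′ x) e)) ⟩
    ⨁ (allFin d) (λ x → (u′ x ∧ w x) xor (e ∧ w x))
      ≡⟨ ⨁-xor (allFin d) (λ x → u′ x ∧ w x) (λ x → e ∧ w x) ⟩
    dot u′ w xor ⨁ (allFin d) (λ x → e ∧ w x)
      ≡⟨ cong (dot u′ w xor_) (trans (⨁-∧ (allFin d) e w) (trans (cong (e ∧_) w∈W₀) (∧-zeroʳ e))) ⟩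
    dot u′ w xor false
      ≡⟨ xor-identityʳ _ ⟩
    dot u′ w ∎
    where
    open ≡-Reasoning

  _<ᵇ_ : Fin d → Fin d → Bool
  i <ᵇ j = does (i <? j)

  <ᵇ-trichotomy : ∀ x y → (x <ᵇ y) xor (y <ᵇ x) ≡ not (δ y x)
  <ᵇ-trichotomy x y with <-cmp x y
  ... | tri< x<y x≢y _   = trans (cong₂ _xor_ (dec-true (x <? y) x<y) (dec-false (y <? x) (λ y<x → <-asym x<y y<x)))
                                 (cong not (sym (δ-≢ (x≢y ∘ sym))))
  ... | tri≈ x≮y refl y≮x = trans (cong₂ _xor_ (dec-false (x <? x) x≮y) (dec-false (x <? x) y≮x)) (cong not (sym (δ-refl x)))
  ... | tri> _ x≢y y<x   = trans (cong₂ _xor_ (dec-false (x <? y) (λ x<y → <-asym x<y y<x)) (dec-true (y <? x) y<x))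
                                 (cong not (sym (δ-≢ (x≢y ∘ sym))))

  ⨁-pairs : ∀ g → ⨁ (pairs d) g ≡ ⨁ (allFin d) (λ i → ⨁ (allFin d) (λ j → (i <ᵇ j) ∧ g (i , j)))
  ⨁-pairs g = trans (⨁-concatMap _ (allFin d) g) (⨁-cong (allFin d) row)
    where
    if-as-∧ : ∀ b y → (if b then y else false) ≡ b ∧ y
    if-as-∧ true  y = refl
    if-as-∧ false y = refl
    row : ∀ i → ⨁ (map (λ j → (i , j)) (filter (i <?_) (allFin d))) g ≡ ⨁ (allFin d) (λ j → (i <ᵇ j) ∧ g (i , j))
    row i = trans (⨁-map (λ j → (i , j)) (filter (i <?_) (allFin d)) g)
           (trans (⨁-filter (i <?_) (allFin d) (λ j → g (i , j))) (⨁-cong (allFin d) (λ j → if-as-∧ (i <ᵇ j) (g (i , j)))))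

  ⨁-δ-row : ∀ x (h : Fin d → Fin d → Bool) → ⨁ (allFin d) (λ p → ⨁ (allFin d) (λ q → δ x p ∧ h p q)) ≡ ⨁ (allFin d) (h x)
  ⨁-δ-row x h = trans (⨁-cong (allFin d) (λ p → trans (⨁-∧ (allFin d) (δ x p) (h p)) (cong (_∧ ⨁ (allFin d) (h p)) (δ-sym x p))))
                      (⨁-δ d x (λ p → ⨁ (allFin d) (h p)))

  ⨁-pairs-through : (S : Fin d → Fin d → Bool) → (∀ p q → S p q ≡ S q p) → ∀ x → S x x ≡ false →
                    ⨁ (pairs d) (λ pq → S (proj₁ pq) (proj₂ pq) ∧ vPair (proj₁ pq) (proj₂ pq) x) ≡ ⨁ (allFin d) (S x)
  ⨁-pairs-through S S-sym x Sxx≡false = begin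
    ⨁ (pairs d) (λ pq → S (proj₁ pq) (proj₂ pq) ∧ vPair (proj₁ pq) (proj₂ pq) x)
      ≡⟨ ⨁-pairs (λ pq → S (proj₁ pq) (proj₂ pq) ∧ vPair (proj₁ pq) (proj₂ pq) x) ⟩
    ⨁ (allFin d) (λ p → ⨁ (allFin d) (λ q → (p <ᵇ q) ∧ (S p q ∧ (δ x p xor δ x q))))
      ≡⟨ ⨁-cong (allFin d) (λ p → trans (⨁-cong (allFin d) (λ q → split (p <ᵇ q) (S p q) (δ x p) (δ x q)))
                                        (⨁-xor (allFin d) (λ q → δ x p ∧ H p q) (λ q → δ x q ∧ H p q))) ⟩
    ⨁ (allFin d) (λ p → ⨁ (allFin d) (λ q → δ x p ∧ H p q) xor ⨁ (allFin d) (λ q → δ x q ∧ H p q))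
      ≡⟨ ⨁-xor (allFin d) (λ p → ⨁ (allFin d) (λ q → δ x p ∧ H p q)) (λ p → ⨁ (allFin d) (λ q → δ x q ∧ H p q)) ⟩
    ⨁ (allFin d) (λ p → ⨁ (allFin d) (λ q → δ x p ∧ H p q)) xor ⨁ (allFin d) (λ p → ⨁ (allFin d) (λ q → δ x q ∧ H p q))
      ≡⟨ cong₂ _xor_ (⨁-δ-row x H)
                     (trans (⨁-swap (allFin d) (allFin d) (λ p q → δ x q ∧ H p q)) (⨁-δ-row x (λ q p → H p q))) ⟩
    ⨁ (allFin d) (H x) xor ⨁ (allFin d) (λ q → H q x)
      ≡⟨ sym (⨁-xor (allFin d) (H x) (λ q → H q x)) ⟩
    ⨁ (allFin d) (λ q → H x q xor H q x)
      ≡⟨ ⨁-cong (allFin d) (λ q → trans (cong (λ s → H x q xor ((q <ᵇ x) ∧ s)) (S-sym q x))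
                                 (trans (sym (∧-distribʳ-xor (S x q) (x <ᵇ q) (q <ᵇ x)))
                                 (trans (cong (_∧ S x q) (<ᵇ-trichotomy x q)) (not-∧ (δ q x) (S x q))))) ⟩
    ⨁ (allFin d) (λ q → S x q xor (δ q x ∧ S x q))
      ≡⟨ ⨁-xor (allFin d) (S x) (λ q → δ q x ∧ S x q) ⟩
    ⨁ (allFin d) (S x) xor ⨁ (allFin d) (λ q → δ q x ∧ S x q)
      ≡⟨ cong (⨁ (allFin d) (S x) xor_) (trans (⨁-δ d x (S x)) Sxx≡false) ⟩
    ⨁ (allFin d) (S x) xor false
      ≡⟨ xor-identityʳ _ ⟩
    ⨁ (allFin d) (S x) ∎
    where
    open ≡-Reasoning
    H : Fin d → Fin d → Bool
    H p q = (p <ᵇ q) ∧ S p q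
    split : ∀ a b c e → a ∧ (b ∧ (c xor e)) ≡ (c ∧ (a ∧ b)) xor (e ∧ (a ∧ b))
    split = solve-∀ 𝔽₂-ring
    not-∧ : ∀ a b → not a ∧ b ≡ b xor (a ∧ b)
    not-∧ false b = sym (xor-identityʳ b)
    not-∧ true  b = sym (xor-same b)

  rowForm : (Fin d → Fin d → Bool) → (Fin d → Bool) → Fin d → Bool
  rowForm c X x = ⨁ (allFin d) (λ y → c x y ∧ (X x xor X y))

  outer : (Fin d → Bool) → (Fin d → Bool) → Fin d → Fin d → Bool
  outer A g p q = (A p ∧ g q) xor (g p ∧ A q)

  rowForm-outer : ∀ A g X → InW₀ d A → InW₀ d g → ∀ x →
                  rowForm (outer A g) X x ≡ (A x ∧ dot g X) xor (g x ∧ dot A X)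
  rowForm-outer A g X A∈W₀ g∈W₀ x = begin
    ⨁ (allFin d) (λ y → ((A x ∧ g y) xor (g x ∧ A y)) ∧ (X x xor X y))
      ≡⟨ ⨁-cong (allFin d) (λ y → expand (A x) (g y) (g x) (A y) (X x) (X y)) ⟩
    ⨁ (allFin d) (λ y → (A x ∧ ((X x ∧ g y) xor (g y ∧ X y))) xor (g x ∧ ((X x ∧ A y) xor (A y ∧ X y))))
      ≡⟨ ⨁-xor (allFin d) (λ y → A x ∧ ((X x ∧ g y) xor (g y ∧ X y))) (λ y → g x ∧ ((X x ∧ A y) xor (A y ∧ X y))) ⟩
    ⨁ (allFin d) (λ y → A x ∧ ((X x ∧ g y) xor (g y ∧ X y))) xor ⨁ (allFin d) (λ y → g x ∧ ((X x ∧ A y) xor (A y ∧ X y)))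
      ≡⟨ cong₂ _xor_ (trans (⨁-∧ (allFin d) (A x) _) (cong (A x ∧_) (pairing g g∈W₀)))
                     (trans (⨁-∧ (allFin d) (g x) _) (cong (g x ∧_) (pairing A A∈W₀))) ⟩
    (A x ∧ dot g X) xor (g x ∧ dot A X) ∎
    where
    open ≡-Reasoning
    expand : ∀ a b c e f h → ((a ∧ b) xor (c ∧ e)) ∧ (f xor h)
                           ≡ (a ∧ ((f ∧ b) xor (b ∧ h))) xor (c ∧ ((f ∧ e) xor (e ∧ h)))
    expand = solve-∀ 𝔽₂-ring
    -- the constant X x pairs to zero with a vector of W₀
    pairing : ∀ h → InW₀ d h → ⨁ (allFin d) (λ y → (X x ∧ h y) xor (h y ∧ X y)) ≡ dot h X
    pairing h h∈W₀ = trans (⨁-xor (allFin d) (λ y → X x ∧ h y) (λ y → h y ∧ X y))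
                           (cong (_xor dot h X) (trans (⨁-∧ (allFin d) (X x) h) (trans (cong (X x ∧_) h∈W₀) (∧-zeroʳ (X x)))))

  VanishOutside : (Fin d → Bool) → Set
  VanishOutside A = ∀ p → ¬ InRange d p → A p ≡ false

  outerCoeffs : ∀ A g → InW₀ d A → InW₀ d g → VanishOutside A → VanishOutside g → N2Coeffs d
  outerCoeffs A g A∈W₀ g∈W₀ A-out g-out = record
    { c        = outer A g
    ; c-sym    = λ p q → swap (A p) (g q) (g p) (A q)
    ; c-diag   = λ p → double (A p) (g p)
    ; c-range  = λ p q p-out → cong₂ (λ a b → (a ∧ g q) xor (b ∧ A q)) (A-out p p-out) (g-out p p-out)
    ; c-rowsum = λ p _ → trans (⨁-xor (allFin d) (λ q → A p ∧ g q) (λ q → g p ∧ A q))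
                         (cong₂ _xor_ (trans (⨁-∧ (allFin d) (A p) g) (trans (cong (A p ∧_) g∈W₀) (∧-zeroʳ (A p))))
                                      (trans (⨁-∧ (allFin d) (g p) A) (trans (cong (g p ∧_) A∈W₀) (∧-zeroʳ (g p)))))
    }
    where
    swap : ∀ a b c e → (a ∧ b) xor (c ∧ e) ≡ (e ∧ c) xor (b ∧ a)
    swap = solve-∀ 𝔽₂-ring
    double : ∀ a b → (a ∧ b) xor (b ∧ a) ≡ false
    double = solve-∀ 𝔽₂-ring

  -- the image in V̄ of ⟨X,v_{k,l}⟩ v_{i,j} + ⟨X,v_{i,j}⟩ v_{k,l}
  swapTarget : Fin d → Fin d → Fin d → Fin d → (Fin d → Bool) → Fin d → Bool
  swapTarget i j k l X x = ((X k xor X l) ∧ vPair i j x) xor ((X i xor X j) ∧ vPair k l x)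

  -- C ∈ N^(2) corrects the commutator of t_{a_{i,j}} and t_{a_{k,l}} (mod 2 shadow)
  Corrects : N2Coeffs d → Fin d → Fin d → Fin d → Fin d → Set
  Corrects C i j k l = ∀ X → InW₀ d X → rowForm (N2Coeffs.c C) X ∼ swapTarget i j k l X

  Correction : Fin d → Fin d → Fin d → Fin d → Set
  Correction i j k l = Σ (N2Coeffs d) (λ C → Corrects C i j k l)

  -- the target is symmetric in the two pairs
  correction-swap : ∀ {i j k l} → Correction k l i j → Correction i j k l
  correction-swap {i} {j} {k} {l} (C , corrects) =
    C , λ X X∈W₀ → ∼-trans (corrects X X∈W₀) (pointwise (λ x → xor-comm ((X i xor X j) ∧ vPair k l x) ((X k xor X l) ∧ vPair i j x)))

  correction-pairs : ∀ i j k l → VanishOutside (vPair i j) → VanishOutside (vPair k l) → Correction i j k l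
  correction-pairs i j k l ij-out kl-out =
    outerCoeffs (vPair i j) (vPair k l) (vPair-W₀ i j) (vPair-W₀ k l) ij-out kl-out ,
    λ X X∈W₀ → pointwise λ x → begin
      rowForm (outer (vPair i j) (vPair k l)) X x
        ≡⟨ rowForm-outer (vPair i j) (vPair k l) X (vPair-W₀ i j) (vPair-W₀ k l) x ⟩
      (vPair i j x ∧ dot (vPair k l) X) xor (vPair k l x ∧ dot (vPair i j) X)
        ≡⟨ cong₂ (λ s t → (vPair i j x ∧ s) xor (vPair k l x ∧ t)) (vPair-dot X k l) (vPair-dot X i j) ⟩
      (vPair i j x ∧ (X k xor X l)) xor (vPair k l x ∧ (X i xor X j))
        ≡⟨ cong₂ _xor_ (∧-comm (vPair i j x) _) (∧-comm (vPair k l x) _) ⟩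
      swapTarget i j k l X x ∎
    where open ≡-Reasoning

  complement : Fin d → Fin d → Fin d → Fin d → Fin d → Bool
  complement i j k l x = (vPair i j x xor vPair k l x) xor true

  complement-W₀ : ∀ i j k l → d ℕ.% 2 ≡ 0 → InW₀ d (complement i j k l)
  complement-W₀ i j k l even = begin
    ⨁ (allFin d) (complement i j k l)
      ≡⟨ ⨁-xor (allFin d) (λ x → vPair i j x xor vPair k l x) (λ _ → true) ⟩
    ⨁ (allFin d) (λ x → vPair i j x xor vPair k l x) xor ⨁ (allFin d) (λ _ → true)
      ≡⟨ cong₂ _xor_ (trans (⨁-xor (allFin d) (vPair i j) (vPair k l)) (cong₂ _xor_ (vPair-W₀ i j) (vPair-W₀ k l)))
                     (⨁-true d even) ⟩
    false ∎
    where open ≡-Reasoning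

  complement-dot : ∀ i j k l X → InW₀ d X → dot (complement i j k l) X ≡ (X i xor X j) xor (X k xor X l)
  complement-dot i j k l X X∈W₀ = begin
    ⨁ (allFin d) (λ y → ((vPair i j y xor vPair k l y) xor true) ∧ X y)
      ≡⟨ ⨁-cong (allFin d) (λ y → distrib (vPair i j y) (vPair k l y) (X y)) ⟩
    ⨁ (allFin d) (λ y → ((X y ∧ vPair i j y) xor (X y ∧ vPair k l y)) xor X y)
      ≡⟨ ⨁-xor (allFin d) (λ y → (X y ∧ vPair i j y) xor (X y ∧ vPair k l y)) X ⟩
    ⨁ (allFin d) (λ y → (X y ∧ vPair i j y) xor (X y ∧ vPair k l y)) xor ⨁ (allFin d) X
      ≡⟨ cong₂ _xor_ (trans (⨁-xor (allFin d) (λ y → X y ∧ vPair i j y) (λ y → X y ∧ vPair k l y))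
                            (cong₂ _xor_ (dot-vPair X i j) (dot-vPair X k l))) X∈W₀ ⟩
    ((X i xor X j) xor (X k xor X l)) xor false
      ≡⟨ xor-identityʳ _ ⟩
    (X i xor X j) xor (X k xor X l) ∎
    where
    open ≡-Reasoning
    distrib : ∀ a b c → ((a xor b) xor true) ∧ c ≡ ((c ∧ a) xor (c ∧ b)) xor c
    distrib = solve-∀ 𝔽₂-ring

  -- for even d, if v_{k,l} does not vanish outside the range, use its complement instead;
  -- the result differs from the target by the constant vector X_i + X_j
  correction-complement : ∀ i j k l → d ℕ.% 2 ≡ 0 → VanishOutside (vPair i j) →
                          VanishOutside (complement i j k l) → Correction i j k l
  correction-complement i j k l even ij-out g-out =
    outerCoeffs A g (vPair-W₀ i j) (complement-W₀ i j k l even) ij-out g-out ,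
    λ X X∈W₀ → shiftBy (X i xor X j) (λ _ → even) λ x → begin
      rowForm (outer A g) X x
        ≡⟨ rowForm-outer A g X (vPair-W₀ i j) (complement-W₀ i j k l even) x ⟩
      (A x ∧ dot g X) xor (g x ∧ dot A X)
        ≡⟨ cong₂ (λ s t → (A x ∧ s) xor (g x ∧ t)) (complement-dot i j k l X X∈W₀) (vPair-dot X i j) ⟩
      (A x ∧ ((X i xor X j) xor (X k xor X l))) xor (((A x xor vPair k l x) xor true) ∧ (X i xor X j))
        ≡⟨ regroup (A x) (vPair k l x) (X i xor X j) (X k xor X l) ⟩
      swapTarget i j k l X x xor (X i xor X j) ∎
    where
    open ≡-Reasoning
    A g : Fin d → Bool
    A = vPair i j
    g = complement i j k l
    regroup : ∀ a b s t → (a ∧ (s xor t)) xor (((a xor b) xor true) ∧ s) ≡ ((t ∧ a) xor (s ∧ b)) xor s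
    regroup = solve-∀ 𝔽₂-ring

  correction-exists : ∀ i j k l → i ≢ j → i ≢ k → i ≢ l → j ≢ k → j ≢ l → k ≢ l → Correction i j k l
  correction-exists i j k l i≢j i≢k i≢l j≢k j≢l k≢l with indexRange d
  ... | inj₁ all-in = correction-pairs i j k l (λ p out → ⊥-elim (out (all-in p))) (λ p out → ⊥-elim (out (all-in p)))
  ... | inj₂ (even , z , only-z) = by-position (z ≟ i) (z ≟ j) (z ≟ k) (z ≟ l)
    where
    vanish : ∀ {A} → A z ≡ false → VanishOutside A
    vanish {A} Az≡false p out = subst (λ q → A q ≡ false) (sym (only-z p out)) Az≡false
    complement-at : ∀ {a b} → a ≡ false → b ≡ true → (a xor b) xor true ≡ false
    complement-at refl refl = refl
    by-position : Dec (z ≡ i) → Dec (z ≡ j) → Dec (z ≡ k) → Dec (z ≡ l) → Correction i j k l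
    by-position (yes refl) _ _ _ = correction-swap (correction-complement k l z j even
      (vanish (vPair-outside i≢k i≢l)) (vanish (complement-at (vPair-outside i≢k i≢l) (vPair-left i≢j))))
    by-position (no _) (yes refl) _ _ = correction-swap (correction-complement k l i z even
      (vanish (vPair-outside j≢k j≢l)) (vanish (complement-at (vPair-outside j≢k j≢l) (vPair-right i≢j))))
    by-position (no _) (no _) (yes refl) _ = correction-complement i j z l even
      (vanish (vPair-outside (i≢k ∘ sym) (j≢k ∘ sym))) (vanish (complement-at (vPair-outside (i≢k ∘ sym) (j≢k ∘ sym)) (vPair-left k≢l)))
    by-position (no _) (no _) (no _) (yes refl) = correction-complement i j k z even
      (vanish (vPair-outside (i≢l ∘ sym) (j≢l ∘ sym))) (vanish (complement-at (vPair-outside (i≢l ∘ sym) (j≢l ∘ sym)) (vPair-right k≢l)))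
    by-position (no z≢i) (no z≢j) (no z≢k) (no z≢l) =
      correction-pairs i j k l (vanish (vPair-outside z≢i z≢j)) (vanish (vPair-outside z≢k z≢l))

module InSetup (d : ℕ) (S : Setup d) where
  open Setup S
  open Coordinates d
  open Linear ident

  r : ℕ
  r = rank d

  M : Fin r → Fin r → ℤ₈
  M m n = φ (B m n)

  M-diag : ∀ m → M m m ≡ # 0
  M-diag m = trans (cong φ (B-diag m)) φ-0

  M-anti : ∀ m n → M m n ≡ - M n m
  M-anti m n = trans (cong φ (B-anti m n)) (φ-neg (B n m))

  open Forms M
  open Alternating M-diag M-anti

  Φ : Vec₂ r → V₈
  Φ v m = φ (v m)

  A : Fin d → Fin d → V₈
  A i j = Φ (a i j)

  φ-form : ∀ v w → φ (form B v w) ≡ ⟪ Φ v , Φ w ⟫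
  φ-form v w = trans (φ-∑ (allFin r) _) (∑-cong (allFin r) λ m → trans (φ-∑ (allFin r) _)
    (∑-cong (allFin r) λ n → trans (φ-* (v m *₂ B m n) (w n)) (cong (_* φ (w n)) (φ-* (v m) (B m n)))))

  φ-t : ∀ i j v m → φ (t i j v m) ≡ T (A i j) (Φ v) m
  φ-t i j v m = trans (φ-+ (v m) (form B v (a i j) *₂ a i j m))
    (cong (φ (v m) +_) (trans (φ-* (form B v (a i j)) (a i j m)) (cong (_* A i j m) (φ-form v (a i j)))))

  φ-t-t : ∀ i j k l v m → φ (t i j (t k l v) m) ≡ T (A i j) (T (A k l) (Φ v)) m
  φ-t-t i j k l v m = trans (φ-t i j (t k l v) m) (T-cong (A i j) (φ-t k l v) m)

  φ-t-t-t : ∀ i j k l v m → φ (t i j (t k l (t i j v)) m) ≡ T (A i j) (T (A k l) (T (A i j) (Φ v))) m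
  φ-t-t-t i j k l v m = trans (φ-t i j (t k l (t i j v)) m) (T-cong (A i j) (φ-t-t k l i j v) m)

  ι : (Fin r → Bool) → Fin d → Bool
  ι = linF₂ ident

  ι-W₀ : ∀ x → InW₀ d (ι x)
  ι-W₀ = linF₂-W₀ ident-W₀

  ι-a : ∀ i j → i ≢ j → ι (red (a i j)) ∼ vPair i j
  ι-a i j i≢j = ≈V̄⇒∼ (a-red i j i≢j)

  ι-injective : ∀ x y → ι x ∼ ι y → ∀ m → x m ≡ y m
  ι-injective x y ιx∼ιy m = xor-≡ (ident-inj (λ m → x m xor y m) (∼⇒≈V̄ ι[x+y]∼0) m)
    where
    ι[x+y]∼0 : ι (λ m → x m xor y m) ∼ zeroF₂
    ι[x+y]∼0 = ∼-trans (pointwise (linF₂-xor x y)) (∼-trans (∼-xor ιx∼ιy ∼-refl) (pointwise (λ i → xor-same (ι y i))))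
    xor-≡ : ∀ {b c} → b xor c ≡ false → b ≡ c
    xor-≡ {false} {false} _ = refl
    xor-≡ {true}  {true}  _ = refl

  parity-form : ∀ v w → parity ⟪ Φ v , Φ w ⟫ ≡ dot (ι (red v)) (ι (red w))
  parity-form v w = trans (cong parity (sym (φ-form v w))) (trans (parity-φ (form B v w)) (form-red v w))

  parity-form-a : ∀ u i j → i ≢ j → parity ⟪ Φ u , A i j ⟫ ≡ ι (red u) i xor ι (red u) j
  parity-form-a u i j i≢j = begin
    parity ⟪ Φ u , A i j ⟫                   ≡⟨ parity-form u (a i j) ⟩
    dot (ι (red u)) (ι (red (a i j)))         ≡⟨ dot-sym (ι (red u)) (ι (red (a i j))) ⟩
    dot (ι (red (a i j))) (ι (red u))         ≡⟨ dot-∼ (ι (red u)) (ι-a i j i≢j) (ι-W₀ (red u)) ⟩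
    dot (vPair i j) (ι (red u))               ≡⟨ vPair-dot (ι (red u)) i j ⟩
    ι (red u) i xor ι (red u) j               ∎
    where open ≡-Reasoning

  parity-form-aa : ∀ i j k l → i ≢ j → k ≢ l → parity ⟪ A i j , A k l ⟫ ≡ vPair i j k xor vPair i j l
  parity-form-aa i j k l i≢j k≢l = begin
    parity ⟪ A i j , A k l ⟫                  ≡⟨ parity-form (a i j) (a k l) ⟩
    dot (ι (red (a i j))) (ι (red (a k l)))   ≡⟨ dot-∼ (ι (red (a k l))) (ι-a i j i≢j) (ι-W₀ (red (a k l))) ⟩
    dot (vPair i j) (ι (red (a k l)))         ≡⟨ dot-sym (vPair i j) (ι (red (a k l))) ⟩
    dot (ι (red (a k l))) (vPair i j)         ≡⟨ dot-∼ (vPair i j) (ι-a k l k≢l) (vPair-W₀ i j) ⟩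
    dot (vPair k l) (vPair i j)               ≡⟨ vPair-dot (vPair i j) k l ⟩
    vPair i j k xor vPair i j l               ∎
    where open ≡-Reasoning

  braid-mod8 : (i j k : Fin d) → i ≢ j → i ≢ k → j ≢ k →
               SameMod2^ 3 (λ v → t i j (t i k (t i j v))) (λ v → t i k (t i j (t i k v)))
  braid-mod8 i j k i≢j i≢k j≢k v m = φ-trunc₃ _ _ (begin
    φ (t i j (t i k (t i j v)) m)                               ≡⟨ φ-t-t-t i j i k v m ⟩
    T (A i j) (T (A i k) (T (A i j) (Φ v))) m                   ≡⟨ braid (A i j) (A i k) (odd-square ⟪ A i j , A i k ⟫ odd) (Φ v) m ⟩
    T (A i k) (T (A i j) (T (A i k) (Φ v))) m                   ≡⟨ sym (φ-t-t-t i k i j v m) ⟩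
    φ (t i k (t i j (t i k v)) m)                               ∎)
    where
    open ≡-Reasoning
    -- a_{i,j} and a_{i,k} meet in one index, so their pairing is odd
    odd : parity ⟪ A i j , A i k ⟫ ≡ true
    odd = trans (parity-form-aa i j i k i≢j i≢k) (cong₂ _xor_ (vPair-left i≢j) (vPair-outside (i≢k ∘ sym) (j≢k ∘ sym)))

  squareTerm : (Fin d → Fin d → Bool) → V₈ → Fin r → Fin d × Fin d → ℤ₈
  squareTerm c y m (p , q) = if c p q then ⟪ y , A p q ⟫ * A p q m else # 0

  tsq-mod4 : ∀ p q y m → # 2 * φ (tsq p q y m) ≡ # 2 * φ (y m) + # 4 * (⟪ Φ y , A p q ⟫ * A p q m)
  tsq-mod4 p q y m = begin
    # 2 * φ (tsq p q y m)                                 ≡⟨ cong (# 2 *_) (φ-t-t p q p q y m) ⟩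
    # 2 * T (A p q) (T (A p q) (Φ y)) m                   ≡⟨ cong (# 2 *_) (T-twice (A p q) (Φ y) m) ⟩
    # 2 * (Φ y m + # 2 * (⟪ Φ y , A p q ⟫ * A p q m))     ≡⟨ distribute (Φ y m) (⟪ Φ y , A p q ⟫ * A p q m) ⟩
    # 2 * φ (y m) + # 4 * (⟪ Φ y , A p q ⟫ * A p q m)     ∎
    where
    open ≡-Reasoning
    distribute : ∀ x z → # 2 * (x + # 2 * z) ≡ # 2 * x + # 4 * z
    distribute = solve-∀ ℤ₈-ring

  squares-mod4 : (c : Fin d → Fin d → Bool) (step : Fin d × Fin d → (Vec₂ r → Vec₂ r) → Vec₂ r → Vec₂ r) →
    (∀ p f v → step p f v ≡ (if c (proj₁ p) (proj₂ p) then tsq (proj₁ p) (proj₂ p) (f v) else f v)) →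
    ∀ L w m → # 2 * φ (foldr step id L w m) ≡ # 2 * φ (w m) + # 4 * ∑ L (squareTerm c (Φ w) m)
  squares-mod4 c step step-spec []      w m = add-zero (# 2 * φ (w m))
    where
    add-zero : ∀ x → x ≡ x + # 4 * # 0
    add-zero = solve-∀ ℤ₈-ring
  squares-mod4 c step step-spec ((p , q) ∷ L) w m =
    trans (cong (λ f → # 2 * φ (f m)) (step-spec (p , q) (foldr step id L) w)) (apply-square (c p q))
    where
    y : Vec₂ r
    y = foldr step id L w
    rest : ℤ₈
    rest = ∑ L (squareTerm c (Φ w) m)
    y≡w : ∀ m → # 2 * φ (y m) ≡ # 2 * φ (w m) + # 4 * ∑ L (squareTerm c (Φ w) m)
    y≡w = squares-mod4 c step step-spec L w
    -- 4⟨y,a⟩ = 4⟨w,a⟩ since y ≡ w modulo 2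
    four-pairing : # 4 * ⟪ Φ y , A p q ⟫ ≡ # 4 * ⟪ Φ w , A p q ⟫
    four-pairing = trans (sym (⟪⟫-*ˡ (# 4) (Φ y) (A p q)))
                   (trans (⟪⟫-congˡ (A p q) (λ n → four-from-two (Φ y n) (Φ w n) (∑ L (squareTerm c (Φ w) n)) (y≡w n))) (⟪⟫-*ˡ (# 4) (Φ w) (A p q)))
    regroup : ∀ x s f a → (x + # 4 * s) + (# 4 * f) * a ≡ x + # 4 * (f * a + s)
    regroup = solve-∀ ℤ₈-ring
    apply-square : ∀ b → # 2 * φ ((if b then tsq p q y else y) m)
                       ≡ # 2 * φ (w m) + # 4 * ((if b then ⟪ Φ w , A p q ⟫ * A p q m else # 0) + rest)
    apply-square false = trans (y≡w m) (cong (λ s → # 2 * φ (w m) + # 4 * s) (zero-left rest))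
      where
      zero-left : ∀ x → x ≡ # 0 + x
      zero-left = solve-∀ ℤ₈-ring
    apply-square true = begin
      # 2 * φ (tsq p q y m)
        ≡⟨ tsq-mod4 p q y m ⟩
      # 2 * φ (y m) + # 4 * (⟪ Φ y , A p q ⟫ * A p q m)
        ≡⟨ cong₂ _+_ (y≡w m) (trans (*-assocℤ₈ (# 4) ⟪ Φ y , A p q ⟫ (A p q m)) (cong (_* A p q m) four-pairing)) ⟩
      (# 2 * φ (w m) + # 4 * rest) + (# 4 * ⟪ Φ w , A p q ⟫) * A p q m
        ≡⟨ regroup (# 2 * φ (w m)) rest ⟪ Φ w , A p q ⟫ (A p q m) ⟩
      # 2 * φ (w m) + # 4 * (⟪ Φ w , A p q ⟫ * A p q m + rest) ∎
      where
      open ≡-Reasoning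
      *-assocℤ₈ : ∀ a b c → a * (b * c) ≡ (a * b) * c
      *-assocℤ₈ = solve-∀ ℤ₈-ring

  N2Rep-mod4 : ∀ C w m → # 2 * φ (N2Rep S C w m) ≡ # 2 * φ (w m) + # 4 * ∑ (pairs d) (squareTerm (N2Coeffs.c C) (Φ w) m)
  N2Rep-mod4 C = squares-mod4 (N2Coeffs.c C) _ (λ _ _ _ → refl) (pairs d)

  pairing₂ : Vec₂ r → Fin d → Fin d → Bool
  pairing₂ u p q = parity ⟪ Φ u , A p q ⟫

  squaresMod2 : (Fin d → Fin d → Bool) → Vec₂ r → Fin r → Bool
  squaresMod2 c u m = ⨁ (pairs d) (λ (p , q) → (c p q ∧ pairing₂ u p q) ∧ red (a p q) m)

  swapMod2 : Fin d → Fin d → Fin d → Fin d → Vec₂ r → Fin r → Bool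
  swapMod2 i j k l u m = (pairing₂ u k l ∧ red (a i j) m) xor (pairing₂ u i j ∧ red (a k l) m)

  ι-squaresMod2 : ∀ C u → ι (squaresMod2 (N2Coeffs.c C) u) ∼ rowForm (N2Coeffs.c C) (ι (red u))
  ι-squaresMod2 C u = begin
    ι (squaresMod2 c u)
      ≈⟨ pointwise (λ x → trans (linF₂-⨁ (pairs d) (λ (p , q) m → (c p q ∧ pairing₂ u p q) ∧ red (a p q) m) x)
                                (⨁-cong (pairs d) (λ (p , q) → linF₂-∧ (c p q ∧ pairing₂ u p q) (red (a p q)) x))) ⟩
      (λ x → ⨁ (pairs d) (λ (p , q) → (c p q ∧ pairing₂ u p q) ∧ ι (red (a p q)) x))
      ≈⟨ ∼-⨁ (pairs d) term∼ ⟩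
      (λ x → ⨁ (pairs d) (λ (p , q) → (c p q ∧ (X p xor X q)) ∧ vPair p q x))
      ≈⟨ pointwise (λ x → ⨁-pairs-through (λ p q → c p q ∧ (X p xor X q)) symmetric x
                                            (trans (cong (c x x ∧_) (xor-same (X x))) (∧-zeroʳ (c x x)))) ⟩
    rowForm c X ∎
    where
    open SetoidReasoning ∼-setoid
    c = N2Coeffs.c C
    X = ι (red u)
    symmetric : ∀ p q → c p q ∧ (X p xor X q) ≡ c q p ∧ (X q xor X p)
    symmetric p q = cong₂ _∧_ (N2Coeffs.c-sym C p q) (xor-comm (X p) (X q))
    term∼ : ∀ pq → (λ x → (c (proj₁ pq) (proj₂ pq) ∧ pairing₂ u (proj₁ pq) (proj₂ pq)) ∧ ι (red (a (proj₁ pq) (proj₂ pq))) x)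
                 ∼ (λ x → (c (proj₁ pq) (proj₂ pq) ∧ (X (proj₁ pq) xor X (proj₂ pq))) ∧ vPair (proj₁ pq) (proj₂ pq) x)
    term∼ (p , q) with c p q in c≡
    ... | false = ∼-refl
    ... | true  = ∼-trans (∼-∧ (pairing₂ u p q) (ι-a p q p≢q)) (pointwise (λ x → cong (_∧ vPair p q x) (parity-form-a u p q p≢q)))
      where
      p≢q : p ≢ q
      p≢q refl with () ← trans (sym c≡) (N2Coeffs.c-diag C p)

  ι-swapMod2 : ∀ i j k l → i ≢ j → k ≢ l → ∀ u → ι (swapMod2 i j k l u) ∼ swapTarget i j k l (ι (red u))
  ι-swapMod2 i j k l i≢j k≢l u = begin
    ι (swapMod2 i j k l u)
      ≈⟨ pointwise (λ x → trans (linF₂-xor (λ m → pairing₂ u k l ∧ red (a i j) m) (λ m → pairing₂ u i j ∧ red (a k l) m) x)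
                               (cong₂ _xor_ (linF₂-∧ (pairing₂ u k l) (red (a i j)) x) (linF₂-∧ (pairing₂ u i j) (red (a k l)) x))) ⟩
    (λ x → (pairing₂ u k l ∧ ι (red (a i j)) x) xor (pairing₂ u i j ∧ ι (red (a k l)) x))
      ≈⟨ ∼-xor (∼-∧ (pairing₂ u k l) (ι-a i j i≢j)) (∼-∧ (pairing₂ u i j) (ι-a k l k≢l)) ⟩
    (λ x → (pairing₂ u k l ∧ vPair i j x) xor (pairing₂ u i j ∧ vPair k l x))
      ≈⟨ pointwise (λ x → cong₂ (λ s s′ → (s ∧ vPair i j x) xor (s′ ∧ vPair k l x))
                                (parity-form-a u k l k≢l) (parity-form-a u i j i≢j)) ⟩
    swapTarget i j k l (ι (red u)) ∎
    where open SetoidReasoning ∼-setoid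

  -- a correcting C realises ⟨u,a_{k,l}⟩ a_{i,j} + ⟨u,a_{i,j}⟩ a_{k,l} modulo 2, by injectivity of ι
  correction-mod2 : ∀ C i j k l → i ≢ j → k ≢ l → Corrects C i j k l → ∀ u m →
                    squaresMod2 (N2Coeffs.c C) u m ≡ swapMod2 i j k l u m
  correction-mod2 C i j k l i≢j k≢l corrects u =
    ι-injective (squaresMod2 (N2Coeffs.c C) u) (swapMod2 i j k l u)
      (∼-trans (ι-squaresMod2 C u) (∼-trans (corrects (ι (red u)) (ι-W₀ (red u))) (∼-sym (ι-swapMod2 i j k l i≢j k≢l u))))

  correction-mod4 : ∀ C i j k l → i ≢ j → k ≢ l → Corrects C i j k l → ∀ u m →
    # 4 * ∑ (pairs d) (squareTerm (N2Coeffs.c C) (Φ u) m) ≡ # 4 * (⟪ Φ u , A k l ⟫ * A i j m + ⟪ Φ u , A i j ⟫ * A k l m)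
  correction-mod4 C i j k l i≢j k≢l corrects u m =
    four-parity (∑ (pairs d) (squareTerm c (Φ u) m)) (⟪ Φ u , A k l ⟫ * A i j m + ⟪ Φ u , A i j ⟫ * A k l m) (begin
    parity (∑ (pairs d) (squareTerm c (Φ u) m))
      ≡⟨ trans (parity-∑ (pairs d) (squareTerm c (Φ u) m)) (⨁-cong (pairs d) parity-term) ⟩
    squaresMod2 c u m
      ≡⟨ correction-mod2 C i j k l i≢j k≢l corrects u m ⟩
    swapMod2 i j k l u m
      ≡⟨ sym (trans (parity-+ (⟪ Φ u , A k l ⟫ * A i j m) (⟪ Φ u , A i j ⟫ * A k l m))
                    (cong₂ _xor_ (parity-*-φ ⟪ Φ u , A k l ⟫ (a i j m)) (parity-*-φ ⟪ Φ u , A i j ⟫ (a k l m)))) ⟩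
    parity (⟪ Φ u , A k l ⟫ * A i j m + ⟪ Φ u , A i j ⟫ * A k l m) ∎)
    where
    open ≡-Reasoning
    c = N2Coeffs.c C
    parity-*-φ : ∀ s x → parity (s * φ x) ≡ parity s ∧ x 0
    parity-*-φ s x = trans (parity-* s (φ x)) (cong (parity s ∧_) (parity-φ x))
    parity-term : ∀ pq → parity (squareTerm c (Φ u) m pq)
                       ≡ (c (proj₁ pq) (proj₂ pq) ∧ pairing₂ u (proj₁ pq) (proj₂ pq)) ∧ red (a (proj₁ pq) (proj₂ pq)) m
    parity-term (p , q) with c p q
    ... | false = refl
    ... | true  = parity-*-φ ⟪ Φ u , A p q ⟫ (a p q m)

  zeroCoeffs : N2Coeffs d
  zeroCoeffs = record { c = λ _ _ → false ; c-sym = λ _ _ → refl ; c-diag = λ _ → refl ; c-range = λ _ _ _ → refl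
                      ; c-rowsum = λ _ _ → ⨁-false (allFin d) }

  module Commutator (i j k l : Fin d) where

    μ : ℤ₈
    μ = ⟪ A i j , A k l ⟫

    defect : Vec₂ r → Fin r → ℤ₈
    defect v m = ⟪ Φ v , A k l ⟫ * A i j m + ⟪ Φ v , A i j ⟫ * A k l m

    twice-commutator : ∀ v m → # 2 * φ (t i j (t k l v) m) ≡ # 2 * φ (t k l (t i j v) m) + - (# 2 * μ) * defect v m
    twice-commutator v m = begin
      # 2 * φ (t i j (t k l v) m)
        ≡⟨ cong (# 2 *_) (trans (φ-t-t i j k l v m) (commutator (A i j) (A k l) (Φ v) m)) ⟩
      # 2 * (T (A k l) (T (A i j) (Φ v)) m + - (μ * defect v m))
        ≡⟨ cong (λ s → # 2 * (s + - (μ * defect v m))) (sym (φ-t-t k l i j v m)) ⟩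
      # 2 * (φ (t k l (t i j v) m) + - (μ * defect v m))
        ≡⟨ distribute (φ (t k l (t i j v) m)) μ (defect v m) ⟩
      # 2 * φ (t k l (t i j v) m) + - (# 2 * μ) * defect v m ∎
      where
      open ≡-Reasoning
      distribute : ∀ x μ q → # 2 * (x + - (μ * q)) ≡ # 2 * x + - (# 2 * μ) * q
      distribute = solve-∀ ℤ₈-ring

    defect-mod4 : # 2 * μ ≡ # 4 → ∀ v m → # 4 * defect (t k l (t i j v)) m ≡ # 4 * defect v m
    defect-mod4 2μ≡4 v m = begin
      # 4 * (⟪ Φ u , B′ ⟫ * A′ m + ⟪ Φ u , A′ ⟫ * B′ m)
        ≡⟨ cong₂ (λ p q → # 4 * (p * A′ m + q * B′ m))
                 (trans (⟪⟫-congˡ B′ (φ-t-t k l i j v)) (⟪TT⟫-right A′ B′ (Φ v)))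
                 (trans (⟪⟫-congˡ A′ (φ-t-t k l i j v)) (⟪TT⟫-left A′ B′ (Φ v))) ⟩
      # 4 * ((β + α * μ) * A′ m + (α + - ((β + α * μ) * μ)) * B′ m)
        ≡⟨ expand α β μ (A′ m) (B′ m) ⟩
      # 4 * (β * A′ m + α * B′ m) + (# 2 * (# 2 * μ)) * (α * A′ m + - ((β + α * μ) * B′ m))
        ≡⟨ cong (λ s → # 4 * (β * A′ m + α * B′ m) + (# 2 * s) * (α * A′ m + - ((β + α * μ) * B′ m))) 2μ≡4 ⟩
      # 4 * (β * A′ m + α * B′ m) + (# 2 * # 4) * (α * A′ m + - ((β + α * μ) * B′ m))
        ≡⟨ eight-vanishes (# 4 * (β * A′ m + α * B′ m)) (α * A′ m + - ((β + α * μ) * B′ m)) ⟩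
      # 4 * (β * A′ m + α * B′ m) ∎
      where
      open ≡-Reasoning
      u = t k l (t i j v)
      A′ = A i j
      B′ = A k l
      α = ⟪ Φ v , A′ ⟫
      β = ⟪ Φ v , B′ ⟫
      expand : ∀ α β μ a b → # 4 * ((β + α * μ) * a + (α + - ((β + α * μ) * μ)) * b)
                           ≡ # 4 * (β * a + α * b) + (# 2 * (# 2 * μ)) * (α * a + - ((β + α * μ) * b))
      expand = solve-∀ ℤ₈-ring
      eight-vanishes : ∀ p q → p + (# 2 * # 4) * q ≡ p
      eight-vanishes = solve-∀ ℤ₈-ring

    commuting : # 2 * μ ≡ # 0 → SameMod2^ 2 (λ v → t i j (t k l v)) (λ v → N2Rep S zeroCoeffs (t k l (t i j v)))
    commuting 2μ≡0 v m = twiceφ-trunc₂ (t i j (t k l v) m) (N2Rep S zeroCoeffs u m) (begin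
      # 2 * φ (t i j (t k l v) m)                         ≡⟨ twice-commutator v m ⟩
      # 2 * φ (u m) + - (# 2 * μ) * defect v m            ≡⟨ cong (λ s → # 2 * φ (u m) + - s * defect v m) 2μ≡0 ⟩
      # 2 * φ (u m) + - # 0 * defect v m                  ≡⟨ vanish (# 2 * φ (u m)) (defect v m) ⟩
      # 2 * φ (u m) + # 4 * # 0                           ≡⟨ cong (λ s → # 2 * φ (u m) + # 4 * s) (sym (∑-0 (pairs d))) ⟩
      # 2 * φ (u m) + # 4 * ∑ (pairs d) (squareTerm (N2Coeffs.c zeroCoeffs) (Φ u) m)
                                                          ≡⟨ sym (N2Rep-mod4 zeroCoeffs u m) ⟩
      # 2 * φ (N2Rep S zeroCoeffs u m)                    ∎)
      where
      open ≡-Reasoning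
      u = t k l (t i j v)
      vanish : ∀ x q → x + - # 0 * q ≡ x + # 4 * # 0
      vanish = solve-∀ ℤ₈-ring

    corrected : i ≢ j → k ≢ l → # 2 * μ ≡ # 4 → ∀ C → Corrects C i j k l →
                SameMod2^ 2 (λ v → t i j (t k l v)) (λ v → N2Rep S C (t k l (t i j v)))
    corrected i≢j k≢l 2μ≡4 C corrects v m = twiceφ-trunc₂ (t i j (t k l v) m) (N2Rep S C u m) (begin
      # 2 * φ (t i j (t k l v) m)                         ≡⟨ twice-commutator v m ⟩
      # 2 * φ (u m) + - (# 2 * μ) * defect v m            ≡⟨ cong (λ s → # 2 * φ (u m) + - s * defect v m) 2μ≡4 ⟩
      # 2 * φ (u m) + - # 4 * defect v m                  ≡⟨ cong (# 2 * φ (u m) +_) (minus-four (defect v m)) ⟩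
      # 2 * φ (u m) + # 4 * defect v m                    ≡⟨ cong (# 2 * φ (u m) +_) (sym (defect-mod4 2μ≡4 v m)) ⟩
      # 2 * φ (u m) + # 4 * defect u m                    ≡⟨ cong (# 2 * φ (u m) +_) (sym (correction-mod4 C i j k l i≢j k≢l corrects u m)) ⟩
      # 2 * φ (u m) + # 4 * ∑ (pairs d) (squareTerm (N2Coeffs.c C) (Φ u) m)
                                                          ≡⟨ sym (N2Rep-mod4 C u m) ⟩
      # 2 * φ (N2Rep S C u m)                             ∎)
      where
      open ≡-Reasoning
      u = t k l (t i j v)
      minus-four : ∀ q → - # 4 * q ≡ # 4 * q
      minus-four = solve-∀ ℤ₈-ring

  commute-mod4 : (i j k l : Fin d) → i ≢ j → i ≢ k → i ≢ l → j ≢ k → j ≢ l → k ≢ l →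
    Σ (N2Coeffs d) (λ C → SameMod2^ 2 (λ v → t i j (t k l v)) (λ v → N2Rep S C (t k l (t i j v))))
  commute-mod4 i j k l i≢j i≢k i≢l j≢k j≢l k≢l = by-μ (even-double μ μ-even)
    where
    open Commutator i j k l
    -- {i,j} and {k,l} are disjoint, so μ = ⟨a_{i,j},a_{k,l}⟩ is even
    μ-even : parity μ ≡ false
    μ-even = trans (parity-form-aa i j k l i≢j k≢l)
                   (cong₂ _xor_ (vPair-outside (i≢k ∘ sym) (j≢k ∘ sym)) (vPair-outside (i≢l ∘ sym) (j≢l ∘ sym)))
    by-μ : (# 2 * μ ≡ # 0) ⊎ (# 2 * μ ≡ # 4) →
           Σ (N2Coeffs d) (λ C → SameMod2^ 2 (λ v → t i j (t k l v)) (λ v → N2Rep S C (t k l (t i j v))))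
    by-μ (inj₁ 2μ≡0) = zeroCoeffs , commuting 2μ≡0
    by-μ (inj₂ 2μ≡4) with correction-exists i j k l i≢j i≢k i≢l j≢k j≢l k≢l
    ... | C , corrects = C , corrected i≢j k≢l 2μ≡4 C corrects

-- Lemma 3.4
lemma3p4 : (d : ℕ) → 3 ≤ d → d ≢ 4 → (S : Setup d) →
    ((i j k : Fin d) → i ≢ j → i ≢ k → j ≢ k →
      SameMod2^ 3 (λ v → Setup.t S i j (Setup.t S i k (Setup.t S i j v)))
                  (λ v → Setup.t S i k (Setup.t S i j (Setup.t S i k v))))
    ×
    ((i j k l : Fin d) → i ≢ j → i ≢ k → i ≢ l → j ≢ k → j ≢ l → k ≢ l →
      Σ (N2Coeffs d) (λ C →
        SameMod2^ 2 (λ v → Setup.t S i j (Setup.t S k l v))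
                    (λ v → N2Rep S C (Setup.t S k l (Setup.t S i j v)))))
lemma3p4 d _ _ S = braid-mod8 , commute-mod4
  where open InSetup d S
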